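{- There are exactly two affine equivalence classes of $7$-dimensional $10$-caps in $\mathbb{Z}_2^n$. In one class, every cap has a basis of extended type $5\text{ - }5\text{ - }(2)$ and also a basis of extended type $7\text{ - }5\text{ - }(4)$. In the other class, every basis of every cap has extended type $5\text{ - }5\text{ - }(3)$.
   Context: Work in $\mathbb{Z}_2^n$. An affine combination of a set is a sum of an odd number of its distinct elements; $\operatorname{aff}(S)$ is the set of all affine combinations of elements of $S$, and the dimension of $S$ is the dimension of the affine flat $\operatorname{aff}(S)$. A basis for $S$ is a subset $B\subseteq S$ that is affinely independent (no element is an affine combination of the others) with $\operatorname{aff}(B)=\operatorname{aff}(S)$; its dependent set is $D=S\setminus B$. For $x\in D$, $B_x$ is the unique subset of $B$ whose elements sum to $x$. A quad is a set of four distinct elements summing to $\mathbf{0}$; a cap is a quad-free subset; a $k$-cap is a cap with $k$ elements. For $D=\{x_1,x_2\}$, a basis $B$ has extended type $n_1\text{ - }n_2\text{ - }(m)$ if the elements of $D$ can be labeled $x_1,x_2$ so that $|B_{x_1}|=n_1$, $|B_{x_2}|=n_2$ and $|B_{x_1}\cap B_{x_2}|=m$. Two subsets $S_1,S_2$ are affinely equivalent if there is an affine isomorphism (invertible map of the form $x\mapsto L(x)+b$, $L$ linear) from $\operatorname{aff}(S_1)$ onto $\operatorname{aff}(S_2)$ mapping $S_1$ onto $S_2$. -}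

module Defs where

open import Data.Bool using (Bool; true; false; _xor_)
open import Data.Nat using (ℕ; zero; suc; _%_; _≤_)
open import Data.Fin using (Fin)
open import Data.Fin.Subset using (Subset; _∈_; _∉_; _⊆_; _∩_; ∣_∣; ⊤)
open import Data.Vec using (Vec; []; _∷_; zipWith; replicate; lookup)
open import Data.Product using (Σ; ∃; ∃-syntax; _×_; _,_)
open import Data.Sum using (_⊎_)
open import Relation.Nullary using (¬_)
open import Relation.Binary.PropositionalEquality using (_≡_; _≢_)

-- Points of Z₂ⁿ: bit vectors, addition is coordinatewise xor.
Pt : ℕ → Set
Pt n = Vec Bool n

_⊕_ : ∀ {n} → Pt n → Pt n → Pt n
_⊕_ = zipWith _xor_

𝟎 : ∀ {n} → Pt n
𝟎 = replicate _ false

-- A finite family of k points (a set when injective).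
Fam : ℕ → ℕ → Set
Fam n k = Vec (Pt n) k

Distinct : ∀ {n k} → Fam n k → Set
Distinct {k = k} S = ∀ (i j : Fin k) → lookup S i ≡ lookup S j → i ≡ j

sumOver : ∀ {n k} → Fam n k → Subset k → Pt n
sumOver []      []          = 𝟎
sumOver (x ∷ S) (true ∷ p)  = x ⊕ sumOver S p
sumOver (x ∷ S) (false ∷ p) = sumOver S p

Odd : ℕ → Set
Odd m = m % 2 ≡ 1

-- x is an affine combination of the elements of S indexed by b
-- (sum of an odd number of distinct such elements).
AffOn : ∀ {n k} → Fam n k → Subset k → Pt n → Set
AffOn {k = k} S b x = ∃[ p ] (p ⊆ b × Odd ∣ p ∣ × sumOver S p ≡ x)

Aff : ∀ {n k} → Fam n k → Pt n → Set
Aff S = AffOn S ⊤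

AffIndepOn : ∀ {n k} → Fam n k → Subset k → Set
AffIndepOn {k = k} S b =
  ∀ (i : Fin k) → i ∈ b → ∀ (p : Subset k) → p ⊆ b → i ∉ p → Odd ∣ p ∣ →
  sumOver S p ≢ lookup S i

HasDim : ∀ {n k} → Fam n k → ℕ → Set
HasDim {n} S d =
  ∃[ A ] (Distinct {n} {suc d} A × (∀ i → Aff S (lookup A i)) × AffIndepOn A ⊤ ×
          (∀ x → (Aff A x → Aff S x) × (Aff S x → Aff A x)))

IsCap : ∀ {n k} → Fam n k → Set
IsCap {k = k} S = ∀ (p : Subset k) → ∣ p ∣ ≡ 4 → sumOver S p ≢ 𝟎

IsDimCap : ∀ {n} → ℕ → (m : ℕ) → Fam n m → Set
IsDimCap d m S = Distinct S × IsCap S × HasDim S d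

IsBasis : ∀ {n k} → Fam n k → Subset k → Set
IsBasis S b = AffIndepOn S b × (∀ x → (AffOn S b x → Aff S x) × (Aff S x → AffOn S b x))

-- basis B (indexed by b) of S has extended type n₁-n₂-(m):
-- D = S ∖ B = {x₁, x₂}, and B_{x₁}, B_{x₂} (subsets of B summing to
-- x₁, x₂) have sizes n₁, n₂ and intersection of size m.
HasExtType : ∀ {n k} → Fam n k → Subset k → ℕ → ℕ → ℕ → Set
HasExtType {k = k} S b n₁ n₂ m =
  ∃[ i₁ ] ∃[ i₂ ] (i₁ ∉ b × i₂ ∉ b × i₁ ≢ i₂ ×
    (∀ (j : Fin k) → j ∉ b → j ≡ i₁ ⊎ j ≡ i₂) ×
    ∃[ p₁ ] ∃[ p₂ ] (p₁ ⊆ b × p₂ ⊆ b ×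
      sumOver S p₁ ≡ lookup S i₁ × sumOver S p₂ ≡ lookup S i₂ ×
      ∣ p₁ ∣ ≡ n₁ × ∣ p₂ ∣ ≡ n₂ × ∣ p₁ ∩ p₂ ∣ ≡ m))

-- linear maps Z₂ⁿ → Z₂ⁿ (additivity is linearity over Z₂)
IsLinear : ∀ {n} → (Pt n → Pt n) → Set
IsLinear L = ∀ x y → L (x ⊕ y) ≡ L x ⊕ L y

AffEquiv : ∀ {n k₁ k₂} → Fam n k₁ → Fam n k₂ → Set
AffEquiv {n} S₁ S₂ =
  ∃[ L ] ∃[ c ] (IsLinear {n} L ×
    let f = λ x → L x ⊕ c in
    (∀ x → Aff S₁ x → Aff S₂ (f x)) ×
    (∀ x y → Aff S₁ x → Aff S₁ y → f x ≡ f y → x ≡ y) ×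
    (∀ y → Aff S₂ y → ∃[ x ] (Aff S₁ x × f x ≡ y)) ×
    (∀ i → ∃[ j ] (f (lookup S₁ i) ≡ lookup S₂ j)) ×
    (∀ j → ∃[ i ] (f (lookup S₁ i) ≡ lookup S₂ j)))

-- A 7-dimensional 10-cap S has a basis B of 8 points and two dependent points x₁, x₂. As S
-- is a cap of distinct points, each B_x has odd size other than 1 and 3, hence 5 or 7, and
-- B_x₁ ⊕ B_x₂ has size neither 0 nor 2. After relabelling B as the first eight indices, a
-- computation over all such pairs of supports shows that the configuration matches one of
-- two models, K₁ of type 5-5-(2) (which also has a basis of type 7-5-(4)) and K₂ of type
-- 5-5-(3); the affine map sending B onto the matching basis of the model is then an affine
-- equivalence. The models are inequivalent because every point of K₁ is an affine combination
-- of the others while one point of K₂ is not. Bases and their extended types are pulled back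
-- along the equivalence; for a cap equivalent to K₂, a basis of another type would make it
-- equivalent to K₁ as well.

module Submission where

open import Defs
open import Algebra.Bundles using (AbelianGroup; CommutativeRing)
open import Algebra.Structures using (IsAbelianGroup)
import Algebra.Properties.AbelianGroup as AbelianGroupProperties
import Algebra.Properties.CommutativeSemigroup as CommutativeSemigroupProperties
open import Data.Bool using (Bool; true; false; _xor_; not; _∧_; if_then_else_)
import Data.Bool as Bool
open import Data.Bool.Properties
  using (xor-assoc; xor-comm; xor-identityˡ; xor-identityʳ; xor-same; xor-∧-commutativeRing; ∧-identityʳ; ∧-distribʳ-xor)
open import Data.Nat using (ℕ; zero; suc; _+_; _≤_; _<_; z≤n; s≤s; _%_; _≤ᵇ_; _≡ᵇ_)
import Data.Nat.Properties as ℕ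
open import Data.Nat.Properties using (≤-<-trans; ≤-pred; m≤n⇒∃[o]m+o≡n)
open import Data.Fin using (Fin; zero; suc; #_; toℕ)
import Data.Fin.Properties as Fin
open import Data.Fin.Properties using (_≟_; suc-injective)
open import Data.Fin.Subset using (Subset; _∈_; _∉_; _⊆_; _∩_; _∪_; ∣_∣; ⊤; ⁅_⁆; ∁)
open import Data.Fin.Subset.Properties
  using (x∈⁅x⁆; x∈⁅y⁆⇒x≡y; x≢y⇒x∉⁅y⁆; nonempty?; Empty-unique; ∣⊥∣≡0; ⊆⊤; ⊆-min; drop-∷-⊆; ∣p∣≤∣x∷p∣;
         ∣⊤∣≡n; _⊆?_; _∈?_; anySubset?; p⊆q⇒∣p∣≤∣q∣)
open import Data.List using (List; []; _∷_; _++_; allFin)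
import Data.List as List
open import Data.List.Membership.Propositional using () renaming (_∈_ to _∈ˡ_)
open import Data.List.Membership.Propositional.Properties using (∈-allFin)
open import Data.List.Relation.Unary.Any using (here; there)
open import Data.Vec using (Vec; []; _∷_; lookup; zipWith; replicate; map; head; tail; tabulate)
import Data.Vec as Vec
open import Data.Vec.Properties
  using (zipWith-assoc; zipWith-comm; zipWith-identityˡ; zipWith-identityʳ; zipWith-distribʳ; lookup-zipWith;
         lookup-replicate; lookup-map; lookup∘tabulate; []=⇒lookup; lookup⇒[]=; ≡-dec)
open import Data.Product using (Σ; ∃; ∃-syntax; _×_; _,_; proj₁; proj₂)
open import Data.Sum using (_⊎_; inj₁; inj₂; [_,_]′)
open import Data.Empty using (⊥-elim)
open import Function using (id; _∘_)
open import Relation.Nullary using (¬_; Dec; yes; no)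
open import Relation.Nullary.Decidable using (map′; _×-dec_; _→-dec_; _⊎-dec_; ¬?; toWitness; ⌊_⌋)
open import Relation.Unary using (Decidable)
open import Relation.Binary.PropositionalEquality
open import Relation.Binary.PropositionalEquality.Algebra using (isMagma)

open ≡-Reasoning

-- The group Z₂ⁿ, subsets and sums

⊕-self : ∀ {n} (x : Pt n) → x ⊕ x ≡ 𝟎
⊕-self []      = refl
⊕-self (a ∷ x) = cong₂ _∷_ (xor-same a) (⊕-self x)

⊕-isAbelianGroup : ∀ {n} → IsAbelianGroup _≡_ (_⊕_ {n}) 𝟎 id
⊕-isAbelianGroup = record
  { isGroup = record
    { isMonoid = record
      { isSemigroup = record { isMagma = isMagma _⊕_ ; assoc = zipWith-assoc xor-assoc }
      ; identity    = zipWith-identityˡ xor-identityˡ , zipWith-identityʳ xor-identityʳ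
      }
    ; inverse = ⊕-self , ⊕-self
    ; ⁻¹-cong = cong id
    }
  ; comm = zipWith-comm xor-comm
  }

⊕-abelianGroup : ℕ → AbelianGroup _ _
⊕-abelianGroup n = record { isAbelianGroup = ⊕-isAbelianGroup {n} }

module _ {n : ℕ} where
  open AbelianGroup (⊕-abelianGroup n) public
    using () renaming (assoc to ⊕-assoc; comm to ⊕-comm;
                       identityˡ to ⊕-identityˡ; identityʳ to ⊕-identityʳ)
  open AbelianGroupProperties (⊕-abelianGroup n) public
    using () renaming (inverseˡ-unique to ⊕≡𝟎⇒≡; xyx⁻¹≈y to x⊕y⊕x≡y)
  open CommutativeSemigroupProperties
    (AbelianGroup.commutativeSemigroup (⊕-abelianGroup n)) public
    using () renaming (interchange to ⊕-interchange; x∙yz≈y∙xz to ⊕-leftCommute)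

⊕-cancelˡ : ∀ {n} (x a b : Pt n) → (x ⊕ a) ⊕ (x ⊕ b) ≡ a ⊕ b
⊕-cancelˡ x a b = begin
  (x ⊕ a) ⊕ (x ⊕ b) ≡⟨ ⊕-interchange x a x b ⟩
  (x ⊕ x) ⊕ (a ⊕ b) ≡⟨ cong (_⊕ (a ⊕ b)) (⊕-self x) ⟩
  𝟎 ⊕ (a ⊕ b)       ≡⟨ ⊕-identityˡ (a ⊕ b) ⟩
  a ⊕ b             ∎

lookup-⊕ : ∀ {n} (x y : Pt n) i → lookup (x ⊕ y) i ≡ lookup x i xor lookup y i
lookup-⊕ x y i = lookup-zipWith _xor_ i x y

lookup-𝟎 : ∀ {n} (i : Fin n) → lookup (𝟎 {n}) i ≡ false
lookup-𝟎 i = lookup-replicate i false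

lookup-ext : ∀ {A : Set} {n} (u v : Vec A n) → (∀ i → lookup u i ≡ lookup v i) → u ≡ v
lookup-ext []      []      h = refl
lookup-ext (a ∷ u) (b ∷ v) h = cong₂ _∷_ (h zero) (lookup-ext u v (λ i → h (suc i)))

true≢false : true ≢ false
true≢false ()

∉⇒lookup≡false : ∀ {k} {i : Fin k} {p : Subset k} → i ∉ p → lookup p i ≡ false
∉⇒lookup≡false {i = i} {p} i∉p with lookup p i in eq
... | true  = ⊥-elim (i∉p (lookup⇒[]= i p eq))
... | false = refl

lookup≡false⇒∉ : ∀ {k} {i : Fin k} {p : Subset k} → lookup p i ≡ false → i ∉ p
lookup≡false⇒∉ eq i∈p = true≢false (trans (sym ([]=⇒lookup i∈p)) eq)

lookup-⁅x⁆ : ∀ {k} (i : Fin k) → lookup ⁅ i ⁆ i ≡ true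
lookup-⁅x⁆ i = []=⇒lookup (x∈⁅x⁆ i)

lookup-⁅y⁆ : ∀ {k} {i j : Fin k} → i ≢ j → lookup ⁅ j ⁆ i ≡ false
lookup-⁅y⁆ i≢j = ∉⇒lookup≡false (x≢y⇒x∉⁅y⁆ i≢j)

⊆⇒lookup : ∀ {k} {p q : Subset k} → p ⊆ q → ∀ i → lookup p i ≡ true → lookup q i ≡ true
⊆⇒lookup p⊆q i eq = []=⇒lookup (p⊆q (lookup⇒[]= i _ eq))

lookup⇒⊆ : ∀ {k} {p q : Subset k} →
  (∀ i → lookup p i ≡ true → lookup q i ≡ true) → p ⊆ q
lookup⇒⊆ {p = p} h {i} i∈p = lookup⇒[]= i _ (h i ([]=⇒lookup i∈p))

xor≡true⇒⊎ : ∀ a b → a xor b ≡ true → a ≡ true ⊎ b ≡ true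
xor≡true⇒⊎ true  b _  = inj₁ refl
xor≡true⇒⊎ false b eq = inj₂ eq

⊕-⊆ : ∀ {k} {p q b : Subset k} → p ⊆ b → q ⊆ b → p ⊕ q ⊆ b
⊕-⊆ {p = p} {q} p⊆b q⊆b = lookup⇒⊆ λ i eq →
  [ ⊆⇒lookup p⊆b i , ⊆⇒lookup q⊆b i ]′
    (xor≡true⇒⊎ (lookup p i) (lookup q i) (trans (sym (lookup-⊕ p q i)) eq))

⁅⁆-⊆ : ∀ {k} {i : Fin k} {b : Subset k} → i ∈ b → ⁅ i ⁆ ⊆ b
⁅⁆-⊆ {i = i} i∈b j∈⁅i⁆ = subst (_∈ _) (sym (x∈⁅y⁆⇒x≡y i j∈⁅i⁆)) i∈b

sumOver-𝟎 : ∀ {n k} (S : Fam n k) → sumOver S 𝟎 ≡ 𝟎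
sumOver-𝟎 []      = refl
sumOver-𝟎 (x ∷ S) = sumOver-𝟎 S

sumOver-⊕ : ∀ {n k} (S : Fam n k) (p q : Subset k) →
  sumOver S (p ⊕ q) ≡ sumOver S p ⊕ sumOver S q
sumOver-⊕ []      []          []          = sym (⊕-identityˡ 𝟎)
sumOver-⊕ (x ∷ S) (true ∷ p)  (true ∷ q)  = trans (sumOver-⊕ S p q) (sym (⊕-cancelˡ x _ _))
sumOver-⊕ (x ∷ S) (true ∷ p)  (false ∷ q) =
  trans (cong (x ⊕_) (sumOver-⊕ S p q)) (sym (⊕-assoc x _ _))
sumOver-⊕ (x ∷ S) (false ∷ p) (true ∷ q)  =
  trans (cong (x ⊕_) (sumOver-⊕ S p q)) (⊕-leftCommute x _ _)
sumOver-⊕ (x ∷ S) (false ∷ p) (false ∷ q) = sumOver-⊕ S p q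

sumOver-⁅⁆ : ∀ {n k} (S : Fam n k) (i : Fin k) → sumOver S ⁅ i ⁆ ≡ lookup S i
sumOver-⁅⁆ (x ∷ S) zero    = trans (cong (x ⊕_) (sumOver-𝟎 S)) (⊕-identityʳ x)
sumOver-⁅⁆ (x ∷ S) (suc i) = sumOver-⁅⁆ S i

parity : ∀ {k} → Subset k → Bool
parity []      = false
parity (b ∷ p) = b xor parity p

oddᵇ : ℕ → Bool
oddᵇ zero          = false
oddᵇ (suc zero)    = true
oddᵇ (suc (suc m)) = oddᵇ m

oddᵇ-suc : ∀ m → oddᵇ (suc m) ≡ not (oddᵇ m)
oddᵇ-suc zero          = refl
oddᵇ-suc (suc zero)    = refl
oddᵇ-suc (suc (suc m)) = oddᵇ-suc m

parity≡oddᵇ∣p∣ : ∀ {k} (p : Subset k) → parity p ≡ oddᵇ ∣ p ∣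
parity≡oddᵇ∣p∣ []          = refl
parity≡oddᵇ∣p∣ (true ∷ p)  = trans (cong not (parity≡oddᵇ∣p∣ p)) (sym (oddᵇ-suc ∣ p ∣))
parity≡oddᵇ∣p∣ (false ∷ p) = parity≡oddᵇ∣p∣ p

Odd⇒oddᵇ : ∀ m → Odd m → oddᵇ m ≡ true
Odd⇒oddᵇ (suc zero)    _ = refl
Odd⇒oddᵇ (suc (suc m)) o = Odd⇒oddᵇ m o

oddᵇ⇒Odd : ∀ m → oddᵇ m ≡ true → Odd m
oddᵇ⇒Odd (suc zero)    _ = refl
oddᵇ⇒Odd (suc (suc m)) e = oddᵇ⇒Odd m e

Odd⇒parity : ∀ {k} (p : Subset k) → Odd ∣ p ∣ → parity p ≡ true
Odd⇒parity p o = trans (parity≡oddᵇ∣p∣ p) (Odd⇒oddᵇ ∣ p ∣ o)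

parity⇒Odd : ∀ {k} (p : Subset k) → parity p ≡ true → Odd ∣ p ∣
parity⇒Odd p e = oddᵇ⇒Odd ∣ p ∣ (trans (sym (parity≡oddᵇ∣p∣ p)) e)

xor-interchange : ∀ a b c d → (a xor b) xor (c xor d) ≡ (a xor c) xor (b xor d)
xor-interchange = CommutativeSemigroupProperties.interchange
  (CommutativeRing.+-commutativeSemigroup xor-∧-commutativeRing)

parity-⊕ : ∀ {k} (p q : Subset k) → parity (p ⊕ q) ≡ parity p xor parity q
parity-⊕ []      []      = refl
parity-⊕ (a ∷ p) (b ∷ q) =
  trans (cong ((a xor b) xor_) (parity-⊕ p q)) (xor-interchange a b (parity p) (parity q))

parity-𝟎 : ∀ k → parity (𝟎 {k}) ≡ false
parity-𝟎 zero    = refl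
parity-𝟎 (suc k) = parity-𝟎 k

parity-⁅⁆ : ∀ {k} (i : Fin k) → parity ⁅ i ⁆ ≡ true
parity-⁅⁆ {suc k} zero = cong not (parity-𝟎 k)
parity-⁅⁆ (suc i)      = parity-⁅⁆ i

lookup-⊕⁅x⁆ : ∀ {k} (q : Subset k) j → lookup (q ⊕ ⁅ j ⁆) j ≡ not (lookup q j)
lookup-⊕⁅x⁆ q j = trans (lookup-⊕ q ⁅ j ⁆ j) (trans (cong (lookup q j xor_) (lookup-⁅x⁆ j)) (xor-true (lookup q j)))
  where
  xor-true : ∀ a → a xor true ≡ not a
  xor-true true  = refl
  xor-true false = refl

lookup-⊕⁅y⁆ : ∀ {k} (q : Subset k) {i j} → i ≢ j → lookup (q ⊕ ⁅ j ⁆) i ≡ lookup q i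
lookup-⊕⁅y⁆ q {i} i≢j = trans (lookup-⊕ q _ i) (trans (cong (lookup q i xor_) (lookup-⁅y⁆ i≢j)) (xor-identityʳ _))

parity-⊕⁅⁆ : ∀ {k} (r : Subset k) i → parity (r ⊕ ⁅ i ⁆) ≡ parity r xor true
parity-⊕⁅⁆ r i = trans (parity-⊕ r ⁅ i ⁆) (cong (parity r xor_) (parity-⁅⁆ i))

sumOver-⊕⁅⁆ : ∀ {n k} (S : Fam n k) r i → sumOver S (r ⊕ ⁅ i ⁆) ≡ sumOver S r ⊕ lookup S i
sumOver-⊕⁅⁆ S r i = trans (sumOver-⊕ S r ⁅ i ⁆) (cong (sumOver S r ⊕_) (sumOver-⁅⁆ S i))

∈⇒∣p∣≡suc∣p⊕⁅x⁆∣ : ∀ {k} (q : Subset k) j → lookup q j ≡ true → ∣ q ∣ ≡ suc ∣ q ⊕ ⁅ j ⁆ ∣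
∈⇒∣p∣≡suc∣p⊕⁅x⁆∣ (true ∷ q)  zero    _ = cong (λ r → suc ∣ r ∣) (sym (⊕-identityʳ q))
∈⇒∣p∣≡suc∣p⊕⁅x⁆∣ (true ∷ q)  (suc j) e = cong suc (∈⇒∣p∣≡suc∣p⊕⁅x⁆∣ q j e)
∈⇒∣p∣≡suc∣p⊕⁅x⁆∣ (false ∷ q) (suc j) e = ∈⇒∣p∣≡suc∣p⊕⁅x⁆∣ q j e

∉⇒∣p⊕⁅x⁆∣≡suc∣p∣ : ∀ {k} (r : Subset k) j → lookup r j ≡ false → ∣ r ⊕ ⁅ j ⁆ ∣ ≡ suc ∣ r ∣
∉⇒∣p⊕⁅x⁆∣≡suc∣p∣ r j e = trans (∈⇒∣p∣≡suc∣p⊕⁅x⁆∣ (r ⊕ ⁅ j ⁆) j (trans (lookup-⊕⁅x⁆ r j) (cong not e)))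
  (cong (λ z → suc ∣ z ∣) (trans (⊕-assoc r _ _) (trans (cong (r ⊕_) (⊕-self _)) (⊕-identityʳ r))))

∣p∣≡0⇒p≡𝟎 : ∀ {k} (r : Subset k) → ∣ r ∣ ≡ 0 → r ≡ 𝟎
∣p∣≡0⇒p≡𝟎 []          _ = refl
∣p∣≡0⇒p≡𝟎 (false ∷ r) e = cong (false ∷_) (∣p∣≡0⇒p≡𝟎 r e)

∣p∣>0⇒nonempty : ∀ {k} (q : Subset k) → 0 < ∣ q ∣ → ∃ λ i → lookup q i ≡ true
∣p∣>0⇒nonempty {k} q 0<∣q∣ with nonempty? q
... | yes (i , i∈q) = i , []=⇒lookup i∈q
... | no  q-empty with Empty-unique q-empty
...   | refl with subst (0 <_) (∣⊥∣≡0 k) 0<∣q∣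
...     | ()

-- Affine independence and affine hulls

EvenIndep : ∀ {n k} → Fam n k → Subset k → Set
EvenIndep S b = ∀ r → r ⊆ b → parity r ≡ false → sumOver S r ≡ 𝟎 → r ≡ 𝟎

AffIndepOn⇒EvenIndep : ∀ {n k} (S : Fam n k) b → AffIndepOn S b → EvenIndep S b
AffIndepOn⇒EvenIndep S b indep r r⊆b even sum≡𝟎 with nonempty? r
... | no  r-empty   = Empty-unique r-empty
... | yes (i , i∈r) = ⊥-elim (indep i (r⊆b i∈r) (r ⊕ ⁅ i ⁆) (⊕-⊆ r⊆b (⁅⁆-⊆ (r⊆b i∈r)))
    (lookup≡false⇒∉ (trans (lookup-⊕⁅x⁆ r i) (cong not ([]=⇒lookup i∈r))))
    (parity⇒Odd (r ⊕ ⁅ i ⁆) (trans (parity-⊕⁅⁆ r i) (cong (_xor true) even)))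
    (trans (sumOver-⊕⁅⁆ S r i) (trans (cong (_⊕ lookup S i) sum≡𝟎) (⊕-identityˡ _))))

EvenIndep⇒AffIndepOn : ∀ {n k} (S : Fam n k) b → EvenIndep S b → AffIndepOn S b
EvenIndep⇒AffIndepOn S b indep i i∈b p p⊆b i∉p odd sum≡Si = true≢false (begin
  true                     ≡⟨ sym (trans (lookup-⊕⁅x⁆ p i) (cong not (∉⇒lookup≡false i∉p))) ⟩
  lookup (p ⊕ ⁅ i ⁆) i     ≡⟨ cong (λ r → lookup r i) r≡𝟎 ⟩
  lookup 𝟎 i               ≡⟨ lookup-𝟎 i ⟩
  false                    ∎)
  where
  r≡𝟎 : p ⊕ ⁅ i ⁆ ≡ 𝟎
  r≡𝟎 = indep (p ⊕ ⁅ i ⁆) (⊕-⊆ p⊆b (⁅⁆-⊆ i∈b))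
    (trans (parity-⊕⁅⁆ p i) (cong (_xor true) (Odd⇒parity p odd)))
    (trans (sumOver-⊕⁅⁆ S p i) (trans (cong (_⊕ lookup S i) sum≡Si) (⊕-self _)))

EvenIndep⇒sumOver-injective : ∀ {n k} (S : Fam n k) b → EvenIndep S b → ∀ p q → p ⊆ b → q ⊆ b →
  parity p ≡ parity q → sumOver S p ≡ sumOver S q → p ≡ q
EvenIndep⇒sumOver-injective S b indep p q p⊆b q⊆b par-eq sum-eq = ⊕≡𝟎⇒≡ p q (indep (p ⊕ q) (⊕-⊆ p⊆b q⊆b)
  (trans (parity-⊕ p q) (trans (cong (_xor parity q) par-eq) (xor-same (parity q))))
  (trans (sumOver-⊕ S p q) (trans (cong (_⊕ sumOver S q) sum-eq) (⊕-self _))))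

AffOn⇒Aff : ∀ {n k} (S : Fam n k) b x → AffOn S b x → Aff S x
AffOn⇒Aff S b x (p , _ , odd , sum) = p , ⊆⊤ , odd , sum

AffOn-mono : ∀ {n k} (S : Fam n k) {b c} → b ⊆ c → ∀ x → AffOn S b x → AffOn S c x
AffOn-mono S b⊆c x (p , p⊆b , odd , sum) = p , (λ i∈p → b⊆c (p⊆b i∈p)) , odd , sum

AffOn-member : ∀ {n k} (S : Fam n k) {b} i → lookup b i ≡ true → AffOn S b (lookup S i)
AffOn-member S i i∈b = ⁅ i ⁆ , ⁅⁆-⊆ (lookup⇒[]= i _ i∈b) , parity⇒Odd ⁅ i ⁆ (parity-⁅⁆ i) , sumOver-⁅⁆ S i

Aff-member : ∀ {n k} (S : Fam n k) i → Aff S (lookup S i)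
Aff-member S i = AffOn-member S i (lookup-replicate i true)

sumOver-AffOn : ∀ {n k m} (S : Fam n k) (T : Fam n m) b q →
  (∀ j → lookup q j ≡ true → AffOn T b (lookup S j)) →
  ∃[ r ] (r ⊆ b × parity r ≡ parity q × sumOver T r ≡ sumOver S q)
sumOver-AffOn {m = m} [] T b [] _ = 𝟎 , ⊆-min b , parity-𝟎 m , sumOver-𝟎 T
sumOver-AffOn (x ∷ S) T b (false ∷ q) h = sumOver-AffOn S T b q (λ j → h (suc j))
sumOver-AffOn (x ∷ S) T b (true ∷ q) h
  with sumOver-AffOn S T b q (λ j → h (suc j)) | h zero refl
... | r , r⊆b , par-r , sum-r | r₀ , r₀⊆b , odd , sum-r₀ =
  r₀ ⊕ r , ⊕-⊆ r₀⊆b r⊆b ,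
  trans (parity-⊕ r₀ r) (cong₂ _xor_ (Odd⇒parity r₀ odd) par-r) ,
  trans (sumOver-⊕ T r₀ r) (cong₂ _⊕_ sum-r₀ sum-r)

Aff⊆AffOn : ∀ {n k m} (S : Fam n k) (T : Fam n m) b →
  (∀ j → AffOn T b (lookup S j)) → ∀ x → Aff S x → AffOn T b x
Aff⊆AffOn S T b h x (p , _ , odd , sum) with sumOver-AffOn S T b p (λ j _ → h j)
... | r , r⊆b , par-r , sum-r = r , r⊆b , parity⇒Odd r (trans par-r (Odd⇒parity p odd)) , trans sum-r sum

-- Gaussian elimination

scale : ∀ {n} → Bool → Pt n → Pt n
scale true  w = w
scale false w = 𝟎

scale-xor : ∀ {n} a d (w : Pt n) → scale (a xor d) w ≡ scale a w ⊕ scale d w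
scale-xor true  true  w = sym (⊕-self w)
scale-xor true  false w = sym (⊕-identityʳ w)
scale-xor false d     w = sym (⊕-identityˡ _)

scale-⊆ : ∀ {k} c {p q : Subset k} → p ⊆ q → scale c p ⊆ q
scale-⊆ true  p⊆q = p⊆q
scale-⊆ false _   = ⊆-min _

sumOver-scale : ∀ {n k} (S : Fam n k) a p → sumOver S (scale a p) ≡ scale a (sumOver S p)
sumOver-scale S true  p = refl
sumOver-scale S false p = sumOver-𝟎 S

sumOver-∷ : ∀ {n k} (u : Pt n) (U : Fam n k) a v → sumOver (u ∷ U) (a ∷ v) ≡ scale a u ⊕ sumOver U v
sumOver-∷ u U true  v = refl
sumOver-∷ u U false v = sym (⊕-identityˡ _)

sumOver-⊕-scale⁅⁆ : ∀ {n k} (X : Fam n k) p c j →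
  sumOver X (p ⊕ scale c ⁅ j ⁆) ≡ sumOver X p ⊕ scale c (lookup X j)
sumOver-⊕-scale⁅⁆ X p c j =
  trans (sumOver-⊕ X p _) (cong (sumOver X p ⊕_) (trans (sumOver-scale X c ⁅ j ⁆) (cong (scale c) (sumOver-⁅⁆ X j))))

dot : ∀ {k} → Vec Bool k → Subset k → Bool
dot A p = parity (p ∩ A)

dot-⊕ : ∀ {k} (A : Vec Bool k) p q → dot A (p ⊕ q) ≡ dot A p xor dot A q
dot-⊕ A p q = trans (cong parity (zipWith-distribʳ ∧-distribʳ-xor A p q)) (parity-⊕ (p ∩ A) (q ∩ A))

dot-𝟎 : ∀ {k} (A : Vec Bool k) → dot A 𝟎 ≡ false
dot-𝟎 []      = refl
dot-𝟎 (a ∷ A) = dot-𝟎 A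

dot-⁅⁆ : ∀ {k} (A : Vec Bool k) j → dot A ⁅ j ⁆ ≡ lookup A j
dot-⁅⁆ (a ∷ A) zero    = trans (cong (a xor_) (dot-𝟎 A)) (xor-identityʳ a)
dot-⁅⁆ (a ∷ A) (suc j) = dot-⁅⁆ A j

dot-scale⁅⁆ : ∀ {k} (A : Vec Bool k) c j → dot A (scale c ⁅ j ⁆) ≡ c ∧ lookup A j
dot-scale⁅⁆ A true  j = dot-⁅⁆ A j
dot-scale⁅⁆ A false j = dot-𝟎 A

dot-vanishing : ∀ {k} (A : Vec Bool k) {q p : Subset k} →
  (∀ j → lookup q j ≡ true → lookup A j ≡ false) → p ⊆ q → dot A p ≡ false
dot-vanishing []      {[]}    {[]}        _ _   = refl
dot-vanishing (a ∷ A) {_ ∷ q} {true ∷ p}  h p⊆q =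
  cong₂ _xor_ (h zero (⊆⇒lookup p⊆q zero refl)) (dot-vanishing A (λ j → h (suc j)) (drop-∷-⊆ p⊆q))
dot-vanishing (a ∷ A) {_ ∷ q} {false ∷ p} h p⊆q = dot-vanishing A (λ j → h (suc j)) (drop-∷-⊆ p⊆q)

dot-constant : ∀ {k} (A : Vec Bool k) p → (∀ j → lookup p j ≡ true → lookup A j ≡ true) → dot A p ≡ parity p
dot-constant []      []          _ = refl
dot-constant (a ∷ A) (true ∷ p)  h = cong₂ _xor_ (h zero refl) (dot-constant A p (λ j → h (suc j)))
dot-constant (a ∷ A) (false ∷ p) h = dot-constant A p (λ j → h (suc j))

heads : ∀ {m k} → Fam (suc m) k → Vec Bool k
heads = map head

tails : ∀ {m k} → Fam (suc m) k → Fam m k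
tails = map tail

sumOver-heads-tails : ∀ {m k} (V : Fam (suc m) k) p →
  sumOver V p ≡ dot (heads V) p ∷ sumOver (tails V) p
sumOver-heads-tails []                []          = refl
sumOver-heads-tails ((a ∷ v) ∷ V) (true ∷ p)  = cong ((a ∷ v) ⊕_) (sumOver-heads-tails V p)
sumOver-heads-tails ((a ∷ v) ∷ V) (false ∷ p) = sumOver-heads-tails V p

lookup-heads-tails : ∀ {m k} (V : Fam (suc m) k) i → lookup V i ≡ lookup (heads V) i ∷ lookup (tails V) i
lookup-heads-tails ((a ∷ v) ∷ V) zero    = refl
lookup-heads-tails (_       ∷ V) (suc i) = lookup-heads-tails V i

Pivot : ∀ {k} → Vec Bool k → Vec Bool k → Set
Pivot q A = ∃ λ j → lookup q j ≡ true × lookup A j ≡ true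

NoPivot : ∀ {k} → Vec Bool k → Vec Bool k → Set
NoPivot q A = ∀ j → lookup q j ≡ true → lookup A j ≡ false

pivot? : ∀ {k} (q A : Vec Bool k) → Pivot q A ⊎ NoPivot q A
pivot? []         []         = inj₂ λ ()
pivot? (true ∷ q) (true ∷ A) = inj₁ (zero , refl , refl)
pivot? (b ∷ q)    (a ∷ A)    = later b a (pivot? q A)
  where
  later : ∀ b a → Pivot q A ⊎ NoPivot q A → Pivot (b ∷ q) (a ∷ A) ⊎ NoPivot (b ∷ q) (a ∷ A)
  later b     a     (inj₁ (j , qj , Aj)) = inj₁ (suc j , qj , Aj)
  later true  true  (inj₂ _)             = inj₁ (zero , refl , refl)
  later true  false (inj₂ h)             = inj₂ λ { zero _ → refl ; (suc j) → h j }
  later false a     (inj₂ h)             = inj₂ λ { (suc j) → h j }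

sumOver-headless : ∀ {m k} (V : Fam (suc m) k) {q p : Subset k} →
  NoPivot q (heads V) → p ⊆ q →
  sumOver V p ≡ false ∷ sumOver (tails V) p
sumOver-headless V {p = p} h p⊆q =
  trans (sumOver-heads-tails V p) (cong (_∷ sumOver (tails V) p) (dot-vanishing (heads V) h p⊆q))

shear : ∀ {n k} → Fam n k → Vec Bool k → Pt n → Fam n k
shear V A w = zipWith (λ v a → v ⊕ scale a w) V A

lookup-shear : ∀ {n k} (V : Fam n k) A w i → lookup (shear V A w) i ≡ lookup V i ⊕ scale (lookup A i) w
lookup-shear V A w i = lookup-zipWith _ i V A

sumOver-shear : ∀ {n k} (V : Fam n k) A w p → sumOver (shear V A w) p ≡ sumOver V p ⊕ scale (dot A p) w
sumOver-shear []      []      w []          = sym (⊕-identityˡ 𝟎)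
sumOver-shear (v ∷ V) (a ∷ A) w (false ∷ p) = sumOver-shear V A w p
sumOver-shear (v ∷ V) (a ∷ A) w (true ∷ p)  = begin
  (v ⊕ scale a w) ⊕ sumOver (shear V A w) p          ≡⟨ cong ((v ⊕ scale a w) ⊕_) (sumOver-shear V A w p) ⟩
  (v ⊕ scale a w) ⊕ (sumOver V p ⊕ scale (dot A p) w) ≡⟨ ⊕-interchange v _ _ _ ⟩
  (v ⊕ sumOver V p) ⊕ (scale a w ⊕ scale (dot A p) w) ≡⟨ cong ((v ⊕ sumOver V p) ⊕_) (sym (scale-xor a _ w)) ⟩
  (v ⊕ sumOver V p) ⊕ scale (a xor dot A p) w          ∎

-- cleared p adds the pivot j₀ to p exactly when the first coordinates of V over p sum to 1,
-- so that the sum of V over cleared p has first coordinate 0.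
module Elimination {m k} (V : Fam (suc m) k) (j₀ : Fin k) (pivot : lookup (heads V) j₀ ≡ true) where

  reduced : Fam m k
  reduced = shear (tails V) (heads V) (lookup (tails V) j₀)

  cleared : Subset k → Subset k
  cleared p = p ⊕ scale (dot (heads V) p) ⁅ j₀ ⁆

  sumOver-cleared : ∀ {n} (X : Fam n k) p → sumOver X (cleared p) ≡ sumOver (shear X (heads V) (lookup X j₀)) p
  sumOver-cleared X p = trans (sumOver-⊕-scale⁅⁆ X p (dot (heads V) p) j₀) (sym (sumOver-shear X (heads V) (lookup X j₀) p))

  sumOver-cleared-pivot : ∀ p → sumOver V (cleared p) ≡ false ∷ sumOver reduced p
  sumOver-cleared-pivot p = trans (sumOver-heads-tails V (cleared p)) (cong₂ _∷_ head≡false (sumOver-cleared (tails V) p))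
    where
    c = dot (heads V) p
    head≡false : dot (heads V) (cleared p) ≡ false
    head≡false = trans (dot-⊕ (heads V) p _)
      (trans (cong (c xor_) (trans (dot-scale⁅⁆ (heads V) c j₀) (trans (cong (c ∧_) pivot) (∧-identityʳ c))))
             (xor-same c))

  cleared-⊆ : ∀ {p q} → p ⊆ q → lookup q j₀ ≡ true → cleared p ⊆ q
  cleared-⊆ {p} {q} p⊆q j₀∈q = ⊕-⊆ p⊆q (scale-⊆ (dot (heads V) p) (⁅⁆-⊆ (lookup⇒[]= j₀ q j₀∈q)))

  lookup-cleared : ∀ p {i} → i ≢ j₀ → lookup (cleared p) i ≡ lookup p i
  lookup-cleared p {i} i≢j₀ = trans (lookup-⊕ p _ i) (trans (cong (lookup p i xor_) (off (dot (heads V) p))) (xor-identityʳ _))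
    where
    off : ∀ c → lookup (scale c ⁅ j₀ ⁆) i ≡ false
    off true  = lookup-⁅y⁆ i≢j₀
    off false = lookup-𝟎 i

Pt₀-unique : (x : Pt 0) → x ≡ 𝟎
Pt₀-unique [] = refl

scale-⊕ : ∀ {n} a (x y : Pt n) → scale a (x ⊕ y) ≡ scale a x ⊕ scale a y
scale-⊕ true  x y = refl
scale-⊕ false x y = sym (⊕-identityˡ 𝟎)

⊕-transpose : ∀ {n} (x y z w : Pt n) → x ⊕ y ≡ z ⊕ w → (w ⊕ y) ⊕ x ≡ z
⊕-transpose x y z w eq = begin
  (w ⊕ y) ⊕ x         ≡⟨ ⊕-comm (w ⊕ y) x ⟩
  x ⊕ (w ⊕ y)         ≡⟨ ⊕-leftCommute x w y ⟩
  w ⊕ (x ⊕ y)         ≡⟨ cong (w ⊕_) eq ⟩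
  w ⊕ (z ⊕ w)         ≡⟨ ⊕-comm w (z ⊕ w) ⟩
  (z ⊕ w) ⊕ w         ≡⟨ ⊕-assoc z w w ⟩
  z ⊕ (w ⊕ w)         ≡⟨ cong (z ⊕_) (⊕-self w) ⟩
  z ⊕ 𝟎               ≡⟨ ⊕-identityʳ z ⟩
  z                   ∎

linearExtension : ∀ n {k m} (V : Fam n k) (T : Fam m k) (q : Subset k) →
  (∀ p → p ⊆ q → sumOver V p ≡ 𝟎 → sumOver T p ≡ 𝟎) →
  ∃[ U ] (∀ i → lookup q i ≡ true → sumOver U (lookup V i) ≡ lookup T i)
linearExtension zero V T q relations = [] , λ i i∈q → begin
  sumOver [] (lookup V i)  ≡⟨ cong (sumOver []) (Pt₀-unique (lookup V i)) ⟩
  𝟎                        ≡⟨ sym (relations ⁅ i ⁆ (⁅⁆-⊆ (lookup⇒[]= i q i∈q)) (Pt₀-unique (sumOver V ⁅ i ⁆))) ⟩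
  sumOver T ⁅ i ⁆          ≡⟨ sumOver-⁅⁆ T i ⟩
  lookup T i               ∎
linearExtension (suc n) V T q relations with pivot? q (heads V)
... | inj₂ no-pivot = 𝟎 ∷ U , extends
  where
  rec = linearExtension n (tails V) T q λ p p⊆q sum≡𝟎 →
    relations p p⊆q (trans (sumOver-headless V no-pivot p⊆q) (cong (false ∷_) sum≡𝟎))
  U = proj₁ rec
  extends : ∀ i → lookup q i ≡ true → sumOver (𝟎 ∷ U) (lookup V i) ≡ lookup T i
  extends i i∈q = begin
    sumOver (𝟎 ∷ U) (lookup V i)                                  ≡⟨ cong (sumOver (𝟎 ∷ U)) (lookup-heads-tails V i) ⟩
    sumOver (𝟎 ∷ U) (lookup (heads V) i ∷ lookup (tails V) i)     ≡⟨ cong (λ a → sumOver (𝟎 ∷ U) (a ∷ lookup (tails V) i)) (no-pivot i i∈q) ⟩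
    sumOver U (lookup (tails V) i)                                ≡⟨ proj₂ rec i i∈q ⟩
    lookup T i                                                    ∎
... | inj₁ (j₀ , j₀∈q , pivot) = u ∷ U , extends
  where
  open Elimination V j₀ pivot
  A = heads V
  T′ = shear T A (lookup T j₀)
  rec = linearExtension n reduced T′ q λ p p⊆q sum≡𝟎 → begin
    sumOver T′ p        ≡⟨ sym (sumOver-cleared T p) ⟩
    sumOver T (cleared p)  ≡⟨ relations (cleared p) (cleared-⊆ p⊆q j₀∈q) (trans (sumOver-cleared-pivot p) (cong (false ∷_) sum≡𝟎)) ⟩
    𝟎                   ∎
  U = proj₁ rec
  w = lookup (tails V) j₀
  u = lookup T j₀ ⊕ sumOver U w
  extends : ∀ i → lookup q i ≡ true → sumOver (u ∷ U) (lookup V i) ≡ lookup T i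
  extends i i∈q = begin
    sumOver (u ∷ U) (lookup V i)                              ≡⟨ cong (sumOver (u ∷ U)) (lookup-heads-tails V i) ⟩
    sumOver (u ∷ U) (a ∷ v)                                   ≡⟨ sumOver-∷ u U a v ⟩
    scale a u ⊕ sumOver U v                                   ≡⟨ cong (_⊕ sumOver U v) (scale-⊕ a (lookup T j₀) (sumOver U w)) ⟩
    (scale a (lookup T j₀) ⊕ scale a (sumOver U w)) ⊕ sumOver U v
                                                              ≡⟨ ⊕-transpose (sumOver U v) _ (lookup T i) _ reduced-image ⟩
    lookup T i                                                ∎
    where
    a = lookup A i
    v = lookup (tails V) i
    reduced-image : sumOver U v ⊕ scale a (sumOver U w) ≡ lookup T i ⊕ scale a (lookup T j₀)
    reduced-image = begin
      sumOver U v ⊕ scale a (sumOver U w)   ≡⟨ cong (sumOver U v ⊕_) (sym (sumOver-scale U a w)) ⟩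
      sumOver U v ⊕ sumOver U (scale a w)   ≡⟨ sym (sumOver-⊕ U v (scale a w)) ⟩
      sumOver U (v ⊕ scale a w)             ≡⟨ cong (sumOver U) (sym (lookup-shear (tails V) A w i)) ⟩
      sumOver U (lookup reduced i)          ≡⟨ proj₂ rec i i∈q ⟩
      lookup T′ i                           ≡⟨ lookup-shear T A (lookup T j₀) i ⟩
      lookup T i ⊕ scale a (lookup T j₀)    ∎

tails-⊆ : ∀ {m k} (V : Fam (suc m) k) {b s} i → lookup V i ⊆ b ∷ s → lookup (tails V) i ⊆ s
tails-⊆ V {b} {s} i Vi⊆ = drop-∷-⊆ (subst (_⊆ (b ∷ s)) (lookup-heads-tails V i) Vi⊆)

Dependency : ∀ {m k} → Fam m k → Subset k → Set
Dependency V q = ∃[ p ] (p ⊆ q × (∃ λ i → lookup p i ≡ true) × sumOver V p ≡ 𝟎)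

linearDependency : ∀ m {k} (V : Fam m k) (q : Subset k) (s : Subset m) →
  (∀ i → lookup q i ≡ true → lookup V i ⊆ s) → ∣ s ∣ < ∣ q ∣ → Dependency V q
linearDependency zero V q [] _ ∣s∣<∣q∣ with ∣p∣>0⇒nonempty q ∣s∣<∣q∣
... | i , i∈q = ⁅ i ⁆ , ⁅⁆-⊆ (lookup⇒[]= i q i∈q) , (i , lookup-⁅x⁆ i) , Pt₀-unique _
linearDependency (suc m) V q (b ∷ s) supp ∣s∣<∣q∣ with pivot? q (heads V)
... | inj₂ no-pivot = conclude (linearDependency m (tails V) q s (λ i i∈q → tails-⊆ V i (supp i i∈q))
                                 (≤-<-trans (∣p∣≤∣x∷p∣ b s) ∣s∣<∣q∣))
  where
  conclude : Dependency (tails V) q → Dependency V q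
  conclude (p , p⊆q , nonempty , sum≡𝟎) =
    p , p⊆q , nonempty , trans (sumOver-headless V no-pivot p⊆q) (cong (false ∷_) sum≡𝟎)
... | inj₁ (j₀ , j₀∈q , pivot) = conclude (linearDependency m reduced q′ s reduced-supp ∣s∣<∣q′∣)
  where
  open Elimination V j₀ pivot
  q′ = q ⊕ ⁅ j₀ ⁆
  q′⊆q : ∀ i → lookup q′ i ≡ true → lookup q i ≡ true × i ≢ j₀
  q′⊆q i i∈q′ with i ≟ j₀
  ... | yes refl = ⊥-elim (true≢false (trans (sym i∈q′) (trans (lookup-⊕⁅x⁆ q i) (cong not j₀∈q))))
  ... | no i≢j₀  = trans (sym (lookup-⊕⁅y⁆ q i≢j₀)) i∈q′ , i≢j₀
  reduced-supp : ∀ i → lookup q′ i ≡ true → lookup reduced i ⊆ s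
  reduced-supp i i∈q′ = subst (_⊆ s) (sym (lookup-shear (tails V) (heads V) _ i))
    (⊕-⊆ (tails-⊆ V i (supp i (proj₁ (q′⊆q i i∈q′)))) (scale-⊆ (lookup (heads V) i) (tails-⊆ V j₀ (supp j₀ j₀∈q))))
  b≡true : b ≡ true
  b≡true = ⊆⇒lookup (subst (_⊆ (b ∷ s)) (lookup-heads-tails V j₀) (supp j₀ j₀∈q)) zero pivot
  ∣s∣<∣q′∣ : ∣ s ∣ < ∣ q′ ∣
  ∣s∣<∣q′∣ = ≤-pred (subst₂ _<_ (cong (λ c → ∣ c ∷ s ∣) b≡true) (∈⇒∣p∣≡suc∣p⊕⁅x⁆∣ q j₀ j₀∈q) ∣s∣<∣q∣)
  conclude : Dependency reduced q′ → Dependency V q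
  conclude (p , p⊆q′ , (i , i∈p) , sum≡𝟎) =
    cleared p , cleared-⊆ p⊆q j₀∈q , (i , trans (lookup-cleared p (proj₂ (i∈q′ i i∈p))) i∈p) ,
    trans (sumOver-cleared-pivot p) (cong (false ∷_) sum≡𝟎)
    where
    i∈q′ : ∀ i → lookup p i ≡ true → lookup q i ≡ true × i ≢ j₀
    i∈q′ i i∈p = q′⊆q i (⊆⇒lookup p⊆q′ i i∈p)
    p⊆q : p ⊆ q
    p⊆q = lookup⇒⊆ λ i i∈p → proj₁ (i∈q′ i i∈p)

IsLin : ∀ {n m} → (Pt n → Pt m) → Set
IsLin L = ∀ x y → L (x ⊕ y) ≡ L x ⊕ L y

IsLin-𝟎 : ∀ {n m} {L : Pt n → Pt m} → IsLin L → L 𝟎 ≡ 𝟎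
IsLin-𝟎 {L = L} lin = begin
  L 𝟎               ≡⟨ sym (⊕-identityʳ (L 𝟎)) ⟩
  L 𝟎 ⊕ 𝟎           ≡⟨ cong (L 𝟎 ⊕_) (sym (⊕-self (L 𝟎))) ⟩
  L 𝟎 ⊕ (L 𝟎 ⊕ L 𝟎) ≡⟨ sym (⊕-assoc (L 𝟎) (L 𝟎) (L 𝟎)) ⟩
  (L 𝟎 ⊕ L 𝟎) ⊕ L 𝟎 ≡⟨ cong (_⊕ L 𝟎) (sym (lin 𝟎 𝟎)) ⟩
  L (𝟎 ⊕ 𝟎) ⊕ L 𝟎   ≡⟨ cong (λ x → L x ⊕ L 𝟎) (⊕-identityˡ 𝟎) ⟩
  L 𝟎 ⊕ L 𝟎         ≡⟨ ⊕-self (L 𝟎) ⟩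
  𝟎                 ∎

sumOver-IsLin : ∀ {n k} (S : Fam n k) → IsLin (sumOver S)
sumOver-IsLin = sumOver-⊕

IsLin-sumOver : ∀ {n m k} {L : Pt n → Pt m} → IsLin L → ∀ (X : Fam n k) p →
  L (sumOver X p) ≡ sumOver (map L X) p
IsLin-sumOver lin []      []          = IsLin-𝟎 lin
IsLin-sumOver lin (x ∷ X) (true ∷ p)  = trans (lin x _) (cong (_ ⊕_) (IsLin-sumOver lin X p))
IsLin-sumOver lin (x ∷ X) (false ∷ p) = IsLin-sumOver lin X p

parity-sumOver : ∀ {k m} (R : Fam m k) p → parity (sumOver R p) ≡ dot (map parity R) p
parity-sumOver {m = m} []      []          = parity-𝟎 m
parity-sumOver         (r ∷ R) (true ∷ p)  = trans (parity-⊕ r _) (cong (parity r xor_) (parity-sumOver R p))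
parity-sumOver         (r ∷ R) (false ∷ p) = parity-sumOver R p

sumOver-cong : ∀ {n k} (X Y : Fam n k) p → (∀ i → lookup p i ≡ true → lookup X i ≡ lookup Y i) →
  sumOver X p ≡ sumOver Y p
sumOver-cong []      []      []          _ = refl
sumOver-cong (x ∷ X) (y ∷ Y) (true ∷ p)  h = cong₂ _⊕_ (h zero refl) (sumOver-cong X Y p (λ i → h (suc i)))
sumOver-cong (x ∷ X) (y ∷ Y) (false ∷ p) h = sumOver-cong X Y p (λ i → h (suc i))

-- Bases

-- Steinitz exchange
EvenIndep-card-≤ : ∀ {n k m} (S₁ : Fam n k) (b₁ : Subset k) (S₂ : Fam n m) (b₂ : Subset m) →
  EvenIndep S₁ b₁ → (∀ i → AffOn S₂ b₂ (lookup S₁ i)) → ∣ b₁ ∣ ≤ ∣ b₂ ∣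
EvenIndep-card-≤ {m = m} S₁ b₁ S₂ b₂ indep span = ℕ.≮⇒≥ no-dependency
  where
  R : Fam m _
  R = tabulate (λ i → proj₁ (span i))
  R-i : ∀ i → lookup R i ≡ proj₁ (span i)
  R-i = lookup∘tabulate _
  R-supp : ∀ i → lookup b₁ i ≡ true → lookup R i ⊆ b₂
  R-supp i _ = subst (_⊆ b₂) (sym (R-i i)) (proj₁ (proj₂ (span i)))
  sumOver-S₁ : ∀ p → sumOver R p ≡ 𝟎 → sumOver S₁ p ≡ 𝟎
  sumOver-S₁ p R-sum≡𝟎 = begin
    sumOver S₁ p                       ≡⟨ sumOver-cong S₁ (map (sumOver S₂) R) p (λ j _ → sym (trans (lookup-map j (sumOver S₂) R)
                                            (trans (cong (sumOver S₂) (R-i j)) (proj₂ (proj₂ (proj₂ (span j))))))) ⟩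
    sumOver (map (sumOver S₂) R) p     ≡⟨ sym (IsLin-sumOver (sumOver-IsLin S₂) R p) ⟩
    sumOver S₂ (sumOver R p)           ≡⟨ cong (sumOver S₂) R-sum≡𝟎 ⟩
    sumOver S₂ 𝟎                       ≡⟨ sumOver-𝟎 S₂ ⟩
    𝟎                                  ∎
  parity-even : ∀ p → sumOver R p ≡ 𝟎 → parity p ≡ false
  parity-even p R-sum≡𝟎 = begin
    parity p                  ≡⟨ sym (dot-constant (map parity R) p (λ j _ → trans (lookup-map j parity R)
                                   (trans (cong parity (R-i j)) (Odd⇒parity (proj₁ (span j)) (proj₁ (proj₂ (proj₂ (span j)))))))) ⟩
    dot (map parity R) p      ≡⟨ sym (parity-sumOver R p) ⟩
    parity (sumOver R p)      ≡⟨ cong parity R-sum≡𝟎 ⟩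
    parity (𝟎 {m})            ≡⟨ parity-𝟎 m ⟩
    false                     ∎
  no-dependency : ¬ (∣ b₂ ∣ < ∣ b₁ ∣)
  no-dependency ∣b₂∣<∣b₁∣ with linearDependency m R b₁ b₂ R-supp ∣b₂∣<∣b₁∣
  ... | p , p⊆b₁ , (i , i∈p) , R-sum≡𝟎 = true≢false (begin
    true          ≡⟨ sym i∈p ⟩
    lookup p i    ≡⟨ cong (λ r → lookup r i) (indep p p⊆b₁ (parity-even p R-sum≡𝟎) (sumOver-S₁ p R-sum≡𝟎)) ⟩
    lookup 𝟎 i    ≡⟨ lookup-𝟎 i ⟩
    false         ∎)

AffOn? : ∀ {n k} (S : Fam n k) b x → Dec (AffOn S b x)
AffOn? S b x = anySubset? λ p → (p ⊆? b) ×-dec ((∣ p ∣ % 2 ℕ.≟ 1) ×-dec ≡-dec Bool._≟_ (sumOver S p) x)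

EvenIndep-𝟎 : ∀ {n k} (S : Fam n k) → EvenIndep S 𝟎
EvenIndep-𝟎 S r r⊆𝟎 _ _ = lookup-ext r 𝟎 λ i → entry i (lookup r i) refl
  where
  entry : ∀ i b → lookup r i ≡ b → lookup r i ≡ lookup 𝟎 i
  entry i true  eq = ⊥-elim (true≢false (trans (sym (⊆⇒lookup r⊆𝟎 i eq)) (lookup-𝟎 i)))
  entry i false eq = trans eq (sym (lookup-𝟎 i))

EvenIndep-insert : ∀ {n k} (S : Fam n k) b j → EvenIndep S b → ¬ AffOn S b (lookup S j) →
  EvenIndep S (b ⊕ ⁅ j ⁆)
EvenIndep-insert S b j indep j∉hull r r⊆ even sum≡𝟎 with lookup r j in r-j
... | false = indep r (lookup⇒⊆ λ i i∈r → below i (⊆⇒lookup r⊆ i i∈r) λ { refl → true≢false (trans (sym i∈r) r-j) })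
                even sum≡𝟎
  where
  below : ∀ i → lookup (b ⊕ ⁅ j ⁆) i ≡ true → i ≢ j → lookup b i ≡ true
  below i i∈ i≢j = trans (sym (lookup-⊕⁅y⁆ b i≢j)) i∈
... | true = ⊥-elim (j∉hull (r ⊕ ⁅ j ⁆ , lookup⇒⊆ r′⊆b ,
               parity⇒Odd (r ⊕ ⁅ j ⁆) (trans (parity-⊕⁅⁆ r j) (cong (_xor true) even)) ,
               trans (sumOver-⊕⁅⁆ S r j) (trans (cong (_⊕ lookup S j) sum≡𝟎) (⊕-identityˡ _))))
  where
  r′⊆b : ∀ i → lookup (r ⊕ ⁅ j ⁆) i ≡ true → lookup b i ≡ true
  r′⊆b i i∈ with i ≟ j
  ... | yes refl = ⊥-elim (true≢false (trans (sym i∈) (trans (lookup-⊕⁅x⁆ r i) (cong not r-j))))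
  ... | no i≢j = trans (sym (lookup-⊕⁅y⁆ b i≢j)) (⊆⇒lookup r⊆ i (trans (sym (lookup-⊕⁅y⁆ r i≢j)) i∈))

⊆-insert : ∀ {k} (b : Subset k) j → lookup b j ≡ false → b ⊆ b ⊕ ⁅ j ⁆
⊆-insert b j b-j = lookup⇒⊆ λ i i∈b → trans (lookup-⊕⁅y⁆ b (λ { refl → true≢false (trans (sym i∈b) b-j) })) i∈b

greedyBasis : ∀ {n k} (S : Fam n k) (l : List (Fin k)) →
  ∃[ b ] (EvenIndep S b × ∀ i → i ∈ˡ l → AffOn S b (lookup S i))
greedyBasis S []      = 𝟎 , EvenIndep-𝟎 S , λ i ()
greedyBasis S (j ∷ l) with greedyBasis S l
... | b , indep , spans with AffOn? S b (lookup S j)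
...   | yes j∈hull = b , indep , λ { i (here refl) → j∈hull ; i (there i∈l) → spans i i∈l }
...   | no  j∉hull = b ⊕ ⁅ j ⁆ , EvenIndep-insert S b j indep j∉hull , spans′
  where
  b-j : lookup b j ≡ false
  b-j with lookup b j in eq
  ... | true  = ⊥-elim (j∉hull (AffOn-member S j eq))
  ... | false = refl
  spans′ : ∀ i → i ∈ˡ j ∷ l → AffOn S (b ⊕ ⁅ j ⁆) (lookup S i)
  spans′ i (here refl)  = AffOn-member S i (trans (lookup-⊕⁅x⁆ b i) (cong not b-j))
  spans′ i (there i∈l) = AffOn-mono S (⊆-insert b j b-j) _ (spans i i∈l)

-- Unfolding the greedy construction on an abstract family branches exponentially.
opaque
  basis-exists : ∀ {n k} (S : Fam n k) → ∃[ b ] (EvenIndep S b × (∀ x → Aff S x → AffOn S b x))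
  basis-exists {k = k} S with greedyBasis S (allFin k)
  ... | b , indep , spans = b , indep , Aff⊆AffOn S S b (λ i → spans i (∈-allFin i))

basis-card : ∀ {n k d} (S : Fam n k) → HasDim S d → ∀ b → EvenIndep S b → (∀ x → Aff S x → AffOn S b x) →
  ∣ b ∣ ≡ suc d
basis-card {d = d} S (A , _ , A⊆hull , A-indep , same-hull) b indep spans = ℕ.≤-antisym
  (subst (∣ b ∣ ≤_) (∣⊤∣≡n (suc d)) (EvenIndep-card-≤ S b A ⊤ indep
    (λ i → proj₂ (same-hull _) (Aff-member S i))))
  (subst (_≤ ∣ b ∣) (∣⊤∣≡n (suc d)) (EvenIndep-card-≤ A ⊤ S b (AffIndepOn⇒EvenIndep A ⊤ A-indep)
    (λ i → spans _ (A⊆hull i))))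

-- Relabelling indices

-- push σ p is the sum of the ⁅ σ i ⁆ for i ∈ p, which is the image of p when σ is injective.
singletons : ∀ {k l} → (Fin k → Fin l) → Fam l k
singletons σ = tabulate (λ i → ⁅ σ i ⁆)

push : ∀ {k l} → (Fin k → Fin l) → Subset k → Subset l
push σ = sumOver (singletons σ)

record AreInverse {k} (σ τ : Fin k → Fin k) : Set where
  constructor inverses
  field
    τ∘σ : ∀ i → τ (σ i) ≡ i
    σ∘τ : ∀ j → σ (τ j) ≡ j

open AreInverse

AreInverse-sym : ∀ {k} {σ τ : Fin k → Fin k} → AreInverse σ τ → AreInverse τ σ
AreInverse-sym (inverses τσ στ) = inverses στ τσ

AreInverse-∘ : ∀ {k} {σ₁ τ₁ σ₂ τ₂ : Fin k → Fin k} → AreInverse σ₁ τ₁ → AreInverse σ₂ τ₂ →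
  AreInverse (λ i → σ₂ (σ₁ i)) (λ j → τ₁ (τ₂ j))
AreInverse-∘ {τ₁ = τ₁} {σ₂ = σ₂} (inverses τσ₁ στ₁) (inverses τσ₂ στ₂) =
  inverses (λ i → trans (cong τ₁ (τσ₂ _)) (τσ₁ i)) (λ j → trans (cong σ₂ (στ₁ _)) (στ₂ j))

AreInverse⇒injective : ∀ {k} {σ τ : Fin k → Fin k} → AreInverse σ τ → ∀ i j → σ i ≡ σ j → i ≡ j
AreInverse⇒injective {τ = τ} inv i j eq = trans (sym (τ∘σ inv i)) (trans (cong τ eq) (τ∘σ inv j))

push-⊕ : ∀ {k l} (σ : Fin k → Fin l) p q → push σ (p ⊕ q) ≡ push σ p ⊕ push σ q
push-⊕ σ = sumOver-⊕ (singletons σ)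

push-𝟎 : ∀ {k l} (σ : Fin k → Fin l) → push σ 𝟎 ≡ 𝟎
push-𝟎 σ = sumOver-𝟎 (singletons σ)

lookup-singletons : ∀ {k l} (σ : Fin k → Fin l) i → lookup (singletons σ) i ≡ ⁅ σ i ⁆
lookup-singletons σ = lookup∘tabulate (λ i → ⁅ σ i ⁆)

push-⁅⁆ : ∀ {k l} (σ : Fin k → Fin l) i → push σ ⁅ i ⁆ ≡ ⁅ σ i ⁆
push-⁅⁆ σ i = trans (sumOver-⁅⁆ (singletons σ) i) (lookup-singletons σ i)

sumOver-push : ∀ {n k l} (S : Fam n l) (σ : Fin k → Fin l) p →
  sumOver S (push σ p) ≡ sumOver (tabulate (λ i → lookup S (σ i))) p
sumOver-push S σ p = trans (IsLin-sumOver (sumOver-IsLin S) (singletons σ) p)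
  (sumOver-cong (map (sumOver S) (singletons σ)) (tabulate (λ i → lookup S (σ i))) p λ i _ → begin
  lookup (map (sumOver S) (singletons σ)) i ≡⟨ lookup-map i (sumOver S) (singletons σ) ⟩
  sumOver S (lookup (singletons σ) i)      ≡⟨ cong (sumOver S) (lookup-singletons σ i) ⟩
  sumOver S ⁅ σ i ⁆                                      ≡⟨ sumOver-⁅⁆ S (σ i) ⟩
  lookup S (σ i)                                         ≡⟨ sym (lookup∘tabulate (λ i → lookup S (σ i)) i) ⟩
  lookup (tabulate (λ i → lookup S (σ i))) i             ∎)

push-∘ : ∀ {k} (σ₂ σ₁ : Fin k → Fin k) p → push (λ i → σ₂ (σ₁ i)) p ≡ push σ₂ (push σ₁ p)
push-∘ σ₂ σ₁ p = sym (trans (sumOver-push (singletons σ₂) σ₁ p)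
  (sumOver-cong (tabulate (λ i → lookup (singletons σ₂) (σ₁ i))) (singletons (λ i → σ₂ (σ₁ i))) p λ i _ →
  trans (lookup∘tabulate (λ i → lookup (singletons σ₂) (σ₁ i)) i) (trans (lookup-singletons σ₂ (σ₁ i)) (sym (lookup-singletons (λ i → σ₂ (σ₁ i)) i)))))

parity-push : ∀ {k l} (σ : Fin k → Fin l) p → parity (push σ p) ≡ parity p
parity-push σ p = trans (parity-sumOver (singletons σ) p) (dot-constant (map parity (singletons σ)) p λ i _ →
  trans (lookup-map i parity (singletons σ)) (trans (cong parity (lookup-singletons σ i)) (parity-⁅⁆ (σ i))))

lookup-sumOver : ∀ {k m} (R : Fam m k) p j → lookup (sumOver R p) j ≡ dot (map (λ r → lookup r j) R) p
lookup-sumOver []      []          j = lookup-𝟎 j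
lookup-sumOver (r ∷ R) (true ∷ p)  j = trans (lookup-⊕ r _ j) (cong (lookup r j xor_) (lookup-sumOver R p j))
lookup-sumOver (r ∷ R) (false ∷ p) j = lookup-sumOver R p j

lookup-push-∉ : ∀ {k l} (σ : Fin k → Fin l) p j →
  (∀ i → lookup p i ≡ true → σ i ≢ j) → lookup (push σ p) j ≡ false
lookup-push-∉ σ p j outside = trans (lookup-sumOver (singletons σ) p j) (dot-vanishing (map (λ r → lookup r j) (singletons σ)) {q = p} (λ i i∈p → begin
  lookup (map (λ r → lookup r j) (singletons σ)) i ≡⟨ lookup-map i (λ r → lookup r j) (singletons σ) ⟩
  lookup (lookup (singletons σ) i) j              ≡⟨ cong (λ r → lookup r j) (lookup-singletons σ i) ⟩
  lookup ⁅ σ i ⁆ j                                             ≡⟨ lookup-⁅y⁆ (λ j≡σi → outside i i∈p (sym j≡σi)) ⟩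
  false                                                        ∎) (λ i∈p → i∈p))

lookup-push : ∀ {k} {σ τ : Fin k → Fin k} → AreInverse σ τ → ∀ p j → lookup (push σ p) j ≡ lookup p (τ j)
lookup-push {σ = σ} {τ} (inverses τσ στ) p j with lookup p (τ j) in p-τj
... | false = lookup-push-∉ σ p j λ i i∈p σi≡j →
                true≢false (trans (sym i∈p) (trans (cong (lookup p) (trans (sym (τσ i)) (cong τ σi≡j))) p-τj))
... | true = begin
  lookup (push σ p) j                            ≡⟨ cong (λ r → lookup (push σ r) j) split ⟩
  lookup (push σ ((p ⊕ ⁅ τ j ⁆) ⊕ ⁅ τ j ⁆)) j     ≡⟨ cong (λ r → lookup r j) (push-⊕ σ (p ⊕ ⁅ τ j ⁆) _) ⟩
  lookup (push σ (p ⊕ ⁅ τ j ⁆) ⊕ push σ ⁅ τ j ⁆) j ≡⟨ lookup-⊕ (push σ (p ⊕ ⁅ τ j ⁆)) (push σ ⁅ τ j ⁆) j ⟩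
  lookup (push σ (p ⊕ ⁅ τ j ⁆)) j xor lookup (push σ ⁅ τ j ⁆) j
        ≡⟨ cong₂ _xor_ rest (trans (cong (λ r → lookup r j) (trans (push-⁅⁆ σ (τ j)) (cong ⁅_⁆ (στ j)))) (lookup-⁅x⁆ j)) ⟩
  true                                           ∎
  where
  split : p ≡ (p ⊕ ⁅ τ j ⁆) ⊕ ⁅ τ j ⁆
  split = sym (trans (⊕-assoc p ⁅ τ j ⁆ ⁅ τ j ⁆) (trans (cong (p ⊕_) (⊕-self _)) (⊕-identityʳ p)))
  rest : lookup (push σ (p ⊕ ⁅ τ j ⁆)) j ≡ false
  rest = lookup-push-∉ σ (p ⊕ ⁅ τ j ⁆) j λ i i∈ σi≡j → true≢false (trans (sym i∈)
    (trans (cong (λ t → lookup (p ⊕ ⁅ t ⁆) i) (trans (cong τ (sym σi≡j)) (τσ i)))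
           (trans (lookup-⊕⁅x⁆ p i) (cong not (trans (cong (lookup p) (trans (sym (τσ i)) (cong τ σi≡j))) p-τj)))))

push-inverse : ∀ {k} {σ τ : Fin k → Fin k} → AreInverse σ τ → ∀ p → push τ (push σ p) ≡ p
push-inverse {σ = σ} {τ} inv p = lookup-ext (push τ (push σ p)) p λ j →
  trans (lookup-push (AreInverse-sym inv) (push σ p) j) (trans (lookup-push inv p (σ j)) (cong (lookup p) (τ∘σ inv j)))

push-⊆ : ∀ {k} {σ τ : Fin k → Fin k} → AreInverse σ τ → ∀ {p b c} → p ⊆ b →
  (∀ i → lookup b i ≡ true → lookup c (σ i) ≡ true) → push σ p ⊆ c
push-⊆ {σ = σ} {τ} inv {p} {b} {c} p⊆b b⊆c = lookup⇒⊆ λ j j∈ →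
  subst (λ i → lookup c i ≡ true) (σ∘τ inv j) (b⊆c (τ j) (⊆⇒lookup p⊆b (τ j) (trans (sym (lookup-push inv p j)) j∈)))

push-∩ : ∀ {k} {σ τ : Fin k → Fin k} → AreInverse σ τ → ∀ p q → push σ (p ∩ q) ≡ push σ p ∩ push σ q
push-∩ {σ = σ} {τ} inv p q = lookup-ext (push σ (p ∩ q)) (push σ p ∩ push σ q) λ j → begin
  lookup (push σ (p ∩ q)) j                 ≡⟨ lookup-push inv (p ∩ q) j ⟩
  lookup (p ∩ q) (τ j)                      ≡⟨ lookup-zipWith _∧_ (τ j) p q ⟩
  lookup p (τ j) ∧ lookup q (τ j)           ≡⟨ sym (cong₂ _∧_ (lookup-push inv p j) (lookup-push inv q j)) ⟩
  lookup (push σ p) j ∧ lookup (push σ q) j ≡⟨ sym (lookup-zipWith _∧_ j (push σ p) (push σ q)) ⟩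
  lookup (push σ p ∩ push σ q) j            ∎

card-push : ∀ {k l} (σ : Fin k → Fin l) → (∀ i j → σ i ≡ σ j → i ≡ j) → ∀ p → ∣ push σ p ∣ ≡ ∣ p ∣
card-push {l = l} σ inj []          = ∣⊥∣≡0 l
card-push         σ inj (false ∷ p) = card-push (λ i → σ (suc i)) (λ i j eq → suc-injective (inj _ _ eq)) p
card-push         σ inj (true ∷ p)  = begin
  ∣ ⁅ σ zero ⁆ ⊕ push σ′ p ∣  ≡⟨ cong ∣_∣ (⊕-comm ⁅ σ zero ⁆ (push σ′ p)) ⟩
  ∣ push σ′ p ⊕ ⁅ σ zero ⁆ ∣  ≡⟨ ∉⇒∣p⊕⁅x⁆∣≡suc∣p∣ (push σ′ p) (σ zero) (lookup-push-∉ σ′ p (σ zero) λ i _ eq → zero≢suc (inj _ _ (sym eq))) ⟩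
  suc ∣ push σ′ p ∣           ≡⟨ cong suc (card-push σ′ (λ i j eq → suc-injective (inj _ _ eq)) p) ⟩
  suc ∣ p ∣                   ∎
  where
  σ′ = λ i → σ (suc i)
  zero≢suc : ∀ {k} {i : Fin k} → Fin.zero ≢ suc i
  zero≢suc ()

-- Affine maps and affine isomorphisms

affine-sumOver : ∀ {n m k} {L : Pt n → Pt m} (c : Pt m) → IsLin L → ∀ (X : Fam n k) p →
  L (sumOver X p) ⊕ scale (parity p) c ≡ sumOver (map (λ x → L x ⊕ c) X) p
affine-sumOver c lin []      []          = trans (⊕-identityʳ _) (IsLin-𝟎 lin)
affine-sumOver c lin (x ∷ X) (false ∷ p) = affine-sumOver c lin X p
affine-sumOver {L = L} c lin (x ∷ X) (true ∷ p) = begin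
  L (x ⊕ sumOver X p) ⊕ scale (true xor parity p) c    ≡⟨ cong₂ _⊕_ (lin x (sumOver X p)) (scale-xor true (parity p) c) ⟩
  (L x ⊕ L (sumOver X p)) ⊕ (c ⊕ scale (parity p) c)  ≡⟨ ⊕-interchange (L x) _ c _ ⟩
  (L x ⊕ c) ⊕ (L (sumOver X p) ⊕ scale (parity p) c)  ≡⟨ cong ((L x ⊕ c) ⊕_) (affine-sumOver c lin X p) ⟩
  (L x ⊕ c) ⊕ sumOver (map (λ x → L x ⊕ c) X) p       ∎

affine-sumOver-odd : ∀ {n m k} {L : Pt n → Pt m} (c : Pt m) → IsLin L → ∀ (X : Fam n k) p → parity p ≡ true →
  L (sumOver X p) ⊕ c ≡ sumOver (map (λ x → L x ⊕ c) X) p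
affine-sumOver-odd {L = L} c lin X p odd =
  trans (cong (λ a → L (sumOver X p) ⊕ scale a c) (sym odd)) (affine-sumOver c lin X p)

affine-sumOver-push : ∀ {n m k l} {L : Pt n → Pt m} (c : Pt m) → IsLin L →
  (S : Fam n k) (C : Fam m l) (σ : Fin k → Fin l) (p : Subset k) → (∀ i → lookup p i ≡ true → L (lookup S i) ⊕ c ≡ lookup C (σ i)) →
  L (sumOver S p) ⊕ scale (parity p) c ≡ sumOver C (push σ p)
affine-sumOver-push {L = L} c linear S C σ p maps = begin
  L (sumOver S p) ⊕ scale (parity p) c               ≡⟨ affine-sumOver c linear S p ⟩
  sumOver (map f S) p                                 ≡⟨ sumOver-cong (map f S) (tabulate (λ i → lookup C (σ i))) p (λ i i∈p →
                                                           trans (lookup-map i f S) (trans (maps i i∈p) (sym (lookup∘tabulate (λ i → lookup C (σ i)) i)))) ⟩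
  sumOver (tabulate (λ i → lookup C (σ i))) p        ≡⟨ sym (sumOver-push C σ p) ⟩
  sumOver C (push σ p)                                ∎
  where
  f = λ x → L x ⊕ c

translate : ∀ {n k} → Fam n k → Fin k → Fam n k
translate X j₀ = shear X ⊤ (lookup X j₀)

sumOver-translate : ∀ {n k} (X : Fam n k) j₀ p →
  sumOver (translate X j₀) p ≡ sumOver X (p ⊕ scale (parity p) ⁅ j₀ ⁆)
sumOver-translate X j₀ p = begin
  sumOver (translate X j₀) p                      ≡⟨ sumOver-shear X ⊤ (lookup X j₀) p ⟩
  sumOver X p ⊕ scale (dot ⊤ p) (lookup X j₀)     ≡⟨ cong (λ a → sumOver X p ⊕ scale a (lookup X j₀)) ⊤-dot ⟩
  sumOver X p ⊕ scale (parity p) (lookup X j₀)    ≡⟨ sym (sumOver-⊕-scale⁅⁆ X p (parity p) j₀) ⟩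
  sumOver X (p ⊕ scale (parity p) ⁅ j₀ ⁆)         ∎
  where
  ⊤-dot : dot ⊤ p ≡ parity p
  ⊤-dot = dot-constant ⊤ p (λ i _ → lookup-replicate i true)

affineExtension : ∀ {n k m} (V : Fam n k) (T : Fam m k) (b : Subset k) → EvenIndep V b →
  ∀ j₀ → lookup b j₀ ≡ true →
  Σ (Pt n → Pt m) λ L → Σ (Pt m) λ c → IsLin L × (∀ i → lookup b i ≡ true → L (lookup V i) ⊕ c ≡ lookup T i)
affineExtension {n} {k} V T b indep j₀ j₀∈b = L , c , sumOver-IsLin U , extends
  where
  relations : ∀ p → p ⊆ b → sumOver (translate V j₀) p ≡ 𝟎 → sumOver (translate T j₀) p ≡ 𝟎
  relations p p⊆b sum≡𝟎 = begin
    sumOver (translate T j₀) p  ≡⟨ sumOver-translate T j₀ p ⟩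
    sumOver T p′                ≡⟨ cong (sumOver T) p′≡𝟎 ⟩
    sumOver T 𝟎                 ≡⟨ sumOver-𝟎 T ⟩
    𝟎                           ∎
    where
    p′ = p ⊕ scale (parity p) ⁅ j₀ ⁆
    p′≡𝟎 : p′ ≡ 𝟎
    p′≡𝟎 = indep p′ (⊕-⊆ p⊆b (scale-⊆ (parity p) (⁅⁆-⊆ (lookup⇒[]= j₀ b j₀∈b))))
      (trans (parity-⊕ p _) (trans (cong (parity p xor_) (parity-scale (parity p))) (xor-same (parity p))))
      (trans (sym (sumOver-translate V j₀ p)) sum≡𝟎)
      where
      parity-scale : ∀ a → parity (scale a ⁅ j₀ ⁆) ≡ a
      parity-scale true  = parity-⁅⁆ j₀
      parity-scale false = parity-𝟎 k
  rec = linearExtension n (translate V j₀) (translate T j₀) b relations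
  U = proj₁ rec
  L = sumOver U
  c = lookup T j₀ ⊕ L (lookup V j₀)
  extends : ∀ i → lookup b i ≡ true → L (lookup V i) ⊕ c ≡ lookup T i
  extends i i∈b = trans (⊕-comm (L (lookup V i)) c) (⊕-transpose (L (lookup V i)) (L (lookup V j₀)) (lookup T i) (lookup T j₀) (begin
    L (lookup V i) ⊕ L (lookup V j₀)    ≡⟨ sym (sumOver-⊕ U (lookup V i) (lookup V j₀)) ⟩
    L (lookup V i ⊕ lookup V j₀)        ≡⟨ cong L (sym (translate-i V)) ⟩
    L (lookup (translate V j₀) i)       ≡⟨ proj₂ rec i i∈b ⟩
    lookup (translate T j₀) i           ≡⟨ translate-i T ⟩
    lookup T i ⊕ lookup T j₀            ∎))
    where
    translate-i : ∀ {n} (X : Fam n _) → lookup (translate X j₀) i ≡ lookup X i ⊕ lookup X j₀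
    translate-i X = trans (lookup-shear X ⊤ (lookup X j₀) i) (cong (λ a → lookup X i ⊕ scale a (lookup X j₀)) (lookup-replicate i true))

record AffIso {n k} (S C : Fam n k) : Set where
  field
    L         : Pt n → Pt n
    c         : Pt n
    linear    : IsLinear L
    σ τ       : Fin k → Fin k
    inverse   : AreInverse σ τ
    maps      : ∀ i → L (lookup S i) ⊕ c ≡ lookup C (σ i)
    injective : ∀ x y → Aff S x → Aff S y → L x ⊕ c ≡ L y ⊕ c → x ≡ y

  f : Pt n → Pt n
  f x = L x ⊕ c

  sumOver-push-affine : ∀ r → L (sumOver S r) ⊕ scale (parity r) c ≡ sumOver C (push σ r)
  sumOver-push-affine r = affine-sumOver-push c linear S C σ r (λ i _ → maps i)

  f-sumOver : ∀ r → parity r ≡ true → f (sumOver S r) ≡ sumOver C (push σ r)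
  f-sumOver r odd = trans (cong (λ a → L (sumOver S r) ⊕ scale a c) (sym odd)) (sumOver-push-affine r)

  f-τ : ∀ j → f (lookup S (τ j)) ≡ lookup C j
  f-τ j = trans (maps (τ j)) (cong (lookup C) (σ∘τ inverse j))

  parity-pullback : ∀ q → parity q ≡ true → parity (push τ q) ≡ true
  parity-pullback q odd = trans (parity-push τ q) odd

  Aff-pullback : ∀ q → parity q ≡ true → Aff S (sumOver S (push τ q))
  Aff-pullback q odd = push τ q , ⊆⊤ , parity⇒Odd (push τ q) (parity-pullback q odd) , refl

  f-pullback : ∀ q → parity q ≡ true → f (sumOver S (push τ q)) ≡ sumOver C q
  f-pullback q odd = trans (f-sumOver (push τ q) (parity-pullback q odd))
                           (cong (sumOver C) (push-inverse (AreInverse-sym inverse) q))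

  pullback-member : ∀ q j → parity q ≡ true → sumOver C q ≡ lookup C j → sumOver S (push τ q) ≡ lookup S (τ j)
  pullback-member q j odd sum≡Cj = injective _ _ (Aff-pullback q odd) (Aff-member S (τ j))
    (trans (f-pullback q odd) (trans sum≡Cj (sym (f-τ j))))

  lookup-pullback : ∀ q i → lookup (push τ q) i ≡ lookup q (σ i)
  lookup-pullback = lookup-push (AreInverse-sym inverse)

  pullback-⊆ : ∀ {p q} → p ⊆ q → push τ p ⊆ push τ q
  pullback-⊆ {p} {q} p⊆q = push-⊆ (AreInverse-sym inverse) p⊆q λ j j∈q →
    trans (lookup-pullback q (τ j)) (subst (λ i → lookup q i ≡ true) (sym (σ∘τ inverse j)) j∈q)

AffIso⇒AffEquiv : ∀ {n k} {S C : Fam n k} → AffIso S C → AffEquiv S C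
AffIso⇒AffEquiv {S = S} {C} iso = L , c , linear , image , injective , onto , (λ i → σ i , maps i) , (λ j → τ j , f-τ j)
  where
  open AffIso iso
  image : ∀ x → Aff S x → Aff C (f x)
  image x (p , _ , odd , sum≡x) = push σ p , ⊆⊤ , parity⇒Odd (push σ p) (trans (parity-push σ p) (Odd⇒parity p odd)) ,
    trans (sym (f-sumOver p (Odd⇒parity p odd))) (cong f sum≡x)
  onto : ∀ y → Aff C y → ∃[ x ] (Aff S x × f x ≡ y)
  onto y (q , _ , odd , sum≡y) = sumOver S (push τ q) , Aff-pullback q (Odd⇒parity q odd) ,
    trans (f-pullback q (Odd⇒parity q odd)) sum≡y

Compatible : ∀ {n k} (S C : Fam n k) (b : Subset k) (σ : Fin k → Fin k) (i : Fin k) → Set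
Compatible S C b σ i =
  ∃[ p ] (p ⊆ b × parity p ≡ true × sumOver S p ≡ lookup S i × sumOver C (push σ p) ≡ lookup C (σ i))

AffIso-fromBasis : ∀ {n k} (S C : Fam n k) (b bC : Subset k) {σ τ : Fin k → Fin k} → AreInverse σ τ →
  EvenIndep S b → (∀ x → Aff S x → AffOn S b x) → EvenIndep C bC →
  (∀ i → lookup b i ≡ true → lookup bC (σ i) ≡ true) → (∀ i → Compatible S C b σ i) →
  ∀ j₀ → lookup b j₀ ≡ true → AffIso S C
AffIso-fromBasis S C b bC {σ} {τ} inv S-indep S-spans C-indep b⇒bC compatible j₀ j₀∈b = record
  { L = L ; c = c ; linear = linear ; σ = σ ; τ = τ ; inverse = inv ; maps = maps ; injective = injective }
  where
  extension = affineExtension S (tabulate (λ i → lookup C (σ i))) b S-indep j₀ j₀∈b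
  L = proj₁ extension
  c = proj₁ (proj₂ extension)
  linear = proj₁ (proj₂ (proj₂ extension))
  f = λ x → L x ⊕ c
  f-sumOver : ∀ p → p ⊆ b → parity p ≡ true → f (sumOver S p) ≡ sumOver C (push σ p)
  f-sumOver p p⊆b odd = trans (cong (λ a → L (sumOver S p) ⊕ scale a c) (sym odd))
    (affine-sumOver-push c linear S C σ p λ i i∈p →
      trans (proj₂ (proj₂ (proj₂ extension)) i (⊆⇒lookup p⊆b i i∈p)) (lookup∘tabulate (λ i → lookup C (σ i)) i))
  maps : ∀ i → f (lookup S i) ≡ lookup C (σ i)
  maps i with compatible i
  ... | p , p⊆b , odd , S-sum , C-sum = trans (cong f (sym S-sum)) (trans (f-sumOver p p⊆b odd) C-sum)
  injective : ∀ x y → Aff S x → Aff S y → f x ≡ f y → x ≡ y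
  injective x y x∈ y∈ fx≡fy with S-spans x x∈ | S-spans y y∈
  ... | p , p⊆b , p-odd , p-sum | q , q⊆b , q-odd , q-sum = begin
    x             ≡⟨ sym p-sum ⟩
    sumOver S p   ≡⟨ cong (sumOver S) p≡q ⟩
    sumOver S q   ≡⟨ q-sum ⟩
    y             ∎
    where
    σ-images : push σ p ≡ push σ q
    σ-images = EvenIndep⇒sumOver-injective C bC C-indep (push σ p) (push σ q) (push-⊆ inv p⊆b b⇒bC) (push-⊆ inv q⊆b b⇒bC)
      (trans (parity-push σ p) (trans (Odd⇒parity p p-odd) (sym (trans (parity-push σ q) (Odd⇒parity q q-odd)))))
      (trans (sym (f-sumOver p p⊆b (Odd⇒parity p p-odd)))
        (trans (cong f p-sum) (trans fx≡fy (trans (cong f (sym q-sum)) (f-sumOver q q⊆b (Odd⇒parity q q-odd))))))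
    p≡q : p ≡ q
    p≡q = trans (sym (push-inverse inv p)) (trans (cong (push τ) σ-images) (push-inverse inv q))

module _ {n k} {S C : Fam n k} (iso : AffIso S C) where
  open AffIso iso

  lookup-pullback-∉ : ∀ {b} i → i ∉ b → τ i ∉ push τ b
  lookup-pullback-∉ {b} i i∉b =
    lookup≡false⇒∉ (trans (lookup-pullback b (τ i)) (trans (cong (lookup b) (σ∘τ inverse i)) (∉⇒lookup≡false i∉b)))

  IsBasis-pullback : ∀ b → IsBasis C b → IsBasis S (push τ b)
  IsBasis-pullback b (C-indep , C-spans) =
    EvenIndep⇒AffIndepOn S (push τ b) S-indep , λ x → AffOn⇒Aff S (push τ b) x , S-spans x
    where
    S-indep : EvenIndep S (push τ b)
    S-indep r r⊆ even sum≡𝟎 = trans (sym (push-inverse inverse r)) (trans (cong (push τ) σ-image≡𝟎) (push-𝟎 τ))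
      where
      σ-image≡𝟎 : push σ r ≡ 𝟎
      σ-image≡𝟎 = AffIndepOn⇒EvenIndep C b C-indep (push σ r)
        (push-⊆ inverse r⊆ λ i i∈ → trans (sym (lookup-pullback b i)) i∈)
        (trans (parity-push σ r) even)
        (begin
          sumOver C (push σ r)                  ≡⟨ sym (sumOver-push-affine r) ⟩
          L (sumOver S r) ⊕ scale (parity r) c  ≡⟨ cong₂ (λ x a → L x ⊕ scale a c) sum≡𝟎 even ⟩
          L 𝟎 ⊕ 𝟎                               ≡⟨ ⊕-identityʳ (L 𝟎) ⟩
          L 𝟎                                   ≡⟨ IsLin-𝟎 linear ⟩
          𝟎                                     ∎)
    S-spans : ∀ x → Aff S x → AffOn S (push τ b) x
    S-spans x x∈ with proj₂ (C-spans (f x)) (proj₁ (proj₂ (proj₂ (proj₂ (AffIso⇒AffEquiv iso)))) x x∈)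
    ... | q , q⊆b , odd , sum≡fx = push τ q , pullback-⊆ q⊆b , parity⇒Odd (push τ q) (parity-pullback q (Odd⇒parity q odd)) ,
      injective _ _ (Aff-pullback q (Odd⇒parity q odd)) x∈ (trans (f-pullback q (Odd⇒parity q odd)) sum≡fx)

  HasExtType-pullback : ∀ b n₁ n₂ m → Odd n₁ → Odd n₂ → HasExtType C b n₁ n₂ m → HasExtType S (push τ b) n₁ n₂ m
  HasExtType-pullback b n₁ n₂ m n₁-odd n₂-odd (i₁ , i₂ , i₁∉b , i₂∉b , i₁≢i₂ , D≡ , p₁ , p₂ , p₁⊆b , p₂⊆b , sum₁ , sum₂ , ∣p₁∣ , ∣p₂∣ , ∣p₁∩p₂∣) =
    τ i₁ , τ i₂ , lookup-pullback-∉ i₁ i₁∉b , lookup-pullback-∉ i₂ i₂∉b ,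
    (λ eq → i₁≢i₂ (trans (sym (σ∘τ inverse i₁)) (trans (cong σ eq) (σ∘τ inverse i₂)))) ,
    D≡′ , push τ p₁ , push τ p₂ , pullback-⊆ p₁⊆b , pullback-⊆ p₂⊆b ,
    pullback-member p₁ i₁ (odd p₁ ∣p₁∣ n₁-odd) sum₁ , pullback-member p₂ i₂ (odd p₂ ∣p₂∣ n₂-odd) sum₂ ,
    trans (card-push τ τ-injective p₁) ∣p₁∣ , trans (card-push τ τ-injective p₂) ∣p₂∣ ,
    trans (cong ∣_∣ (sym (push-∩ (AreInverse-sym inverse) p₁ p₂))) (trans (card-push τ τ-injective (p₁ ∩ p₂)) ∣p₁∩p₂∣)
    where
    τ-injective = AreInverse⇒injective (AreInverse-sym inverse)
    odd : ∀ p {n′} → ∣ p ∣ ≡ n′ → Odd n′ → parity p ≡ true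
    odd p ∣p∣≡n′ n′-odd = Odd⇒parity p (subst Odd (sym ∣p∣≡n′) n′-odd)
    D≡′ : ∀ j → j ∉ push τ b → j ≡ τ i₁ ⊎ j ≡ τ i₂
    D≡′ j j∉ with D≡ (σ j) (lookup≡false⇒∉ (trans (sym (lookup-pullback b j)) (∉⇒lookup≡false j∉)))
    ... | inj₁ eq = inj₁ (trans (sym (τ∘σ inverse j)) (cong τ eq))
    ... | inj₂ eq = inj₂ (trans (sym (τ∘σ inverse j)) (cong τ eq))

-- Whether every point is an affine combination of the others is an affine invariant;
-- it separates the two classes.
Redundant : ∀ {n k} → Fam n k → Fin k → Set
Redundant S i = ∃[ p ] (lookup p i ≡ false × parity p ≡ true × sumOver S p ≡ lookup S i)

AllRedundant : ∀ {n k} → Fam n k → Set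
AllRedundant {k = k} S = ∀ (i : Fin k) → Redundant S i

SomeEssential : ∀ {n k} → Fam n k → Set
SomeEssential {k = k} S = ∃[ i ] ¬ Redundant S i

AllRedundant⇒¬SomeEssential : ∀ {n k} (S : Fam n k) → AllRedundant S → ¬ SomeEssential S
AllRedundant⇒¬SomeEssential S redundant (i , essential) = essential (redundant i)

module _ {n k} {S C : Fam n k} (iso : AffIso S C) where
  open AffIso iso

  SomeEssential-pullback : SomeEssential C → SomeEssential S
  SomeEssential-pullback (j , essential) = τ j , λ (p , p-j , odd , sum≡) → essential
    (push σ p , trans (lookup-push inverse p j) p-j , trans (parity-push σ p) odd ,
     trans (sym (f-sumOver p odd)) (trans (cong f sum≡) (f-τ j)))

  AllRedundant-pullback : AllRedundant C → AllRedundant S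
  AllRedundant-pullback redundant i with redundant (σ i)
  ... | q , q-σi , odd , sum≡ = push τ q , trans (lookup-pullback q i) q-σi , parity-pullback q odd ,
    trans (pullback-member q (σ i) odd sum≡) (cong (lookup S) (τ∘σ inverse i))

module _ {n k l} (S : Fam n k) (T : Fam n l) (equiv : AffEquiv S T) where
  private
    L = proj₁ equiv
    c = proj₁ (proj₂ equiv)
    linear = proj₁ (proj₂ (proj₂ equiv))
    injective = proj₁ (proj₂ (proj₂ (proj₂ (proj₂ equiv))))
    forth = proj₁ (proj₂ (proj₂ (proj₂ (proj₂ (proj₂ (proj₂ equiv))))))
    back = proj₂ (proj₂ (proj₂ (proj₂ (proj₂ (proj₂ (proj₂ equiv))))))
    f = λ x → L x ⊕ c
    σ = λ i → proj₁ (forth i)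
    ρ = λ j → proj₁ (back j)

    f-sumOver : ∀ {m} (X Y : Fam n m) → (∀ i → f (lookup X i) ≡ lookup Y i) →
      ∀ p → parity p ≡ true → f (sumOver X p) ≡ sumOver Y p
    f-sumOver X Y maps p odd = trans (affine-sumOver-odd c linear X p odd)
      (sumOver-cong (map f X) Y p (λ i _ → trans (lookup-map i f X) (maps i)))

  AllRedundant-transport : Distinct S → AllRedundant S → AllRedundant T
  AllRedundant-transport S-distinct redundant j with redundant (ρ j)
  ... | p , p-ρj , odd , sum≡ = push σ p , lookup-push-∉ σ p j σ-avoids-j , trans (parity-push σ p) odd ,
    trans (sumOver-push T σ p) (trans (sym (f-sumOver S (tabulate (λ i → lookup T (σ i)))
      (λ i → trans (proj₂ (forth i)) (sym (lookup∘tabulate _ i))) p odd)) (trans (cong f sum≡) (proj₂ (back j))))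
    where
    σ-avoids-j : ∀ i → lookup p i ≡ true → σ i ≢ j
    σ-avoids-j i i∈p σi≡j = true≢false (trans (sym i∈p) (trans (cong (lookup p) i≡ρj) p-ρj))
      where
      i≡ρj : i ≡ ρ j
      i≡ρj = S-distinct i (ρ j) (injective _ _ (Aff-member S i) (Aff-member S (ρ j))
        (trans (proj₂ (forth i)) (trans (cong (lookup T) σi≡j) (sym (proj₂ (back j))))))

  SomeEssential-transport : Distinct T → SomeEssential S → SomeEssential T
  SomeEssential-transport T-distinct (i , essential) = σ i , λ (q , q-σi , odd , sum≡) → essential
    (push ρ q , lookup-push-∉ ρ q i (ρ-avoids-i q q-σi) , trans (parity-push ρ q) odd ,
     injective _ _ (push ρ q , ⊆⊤ , parity⇒Odd (push ρ q) (trans (parity-push ρ q) odd) , refl) (Aff-member S i)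
       (trans (cong f (sumOver-push S ρ q)) (trans (f-sumOver (tabulate (λ j → lookup S (ρ j))) T
         (λ j → trans (cong f (lookup∘tabulate _ j)) (proj₂ (back j))) q odd)
         (trans sum≡ (sym (proj₂ (forth i)))))))
    where
    ρ-avoids-i : ∀ q → lookup q (σ i) ≡ false → ∀ j → lookup q j ≡ true → ρ j ≢ i
    ρ-avoids-i q q-σi j j∈q ρj≡i = true≢false (trans (sym j∈q) (trans (cong (lookup q) j≡σi) q-σi))
      where
      j≡σi : j ≡ σ i
      j≡σi = T-distinct j (σ i) (trans (sym (proj₂ (back j))) (trans (cong (λ i → f (lookup S i)) ρj≡i) (proj₂ (forth i))))

-- Deciding finite properties

infix 4 _≟ᵖ_
_≟ᵖ_ : ∀ {n} (x y : Pt n) → Dec (x ≡ y)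
_≟ᵖ_ = ≡-dec Bool._≟_

allSubset? : ∀ {k} {P : Subset k → Set} → Decidable P → Dec (∀ p → P p)
allSubset? {zero}  P? = map′ (λ { P[] [] → P[] }) (λ ∀P → ∀P []) (P? [])
allSubset? {suc k} P? = map′ (λ { (P-in , P-out) (true ∷ p) → P-in p ; (P-in , P-out) (false ∷ p) → P-out p })
  (λ ∀P → (λ p → ∀P (true ∷ p)) , (λ p → ∀P (false ∷ p)))
  (allSubset? (P? ∘ (true ∷_)) ×-dec allSubset? (P? ∘ (false ∷_)))

Distinct? : ∀ {n k} (S : Fam n k) → Dec (Distinct S)
Distinct? S = Fin.all? λ i → Fin.all? λ j → (lookup S i ≟ᵖ lookup S j) →-dec (i Fin.≟ j)

IsCap? : ∀ {n k} (S : Fam n k) → Dec (IsCap S)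
IsCap? S = allSubset? λ p → (∣ p ∣ ℕ.≟ 4) →-dec ¬? (sumOver S p ≟ᵖ 𝟎)

EvenIndep? : ∀ {n k} (S : Fam n k) b → Dec (EvenIndep S b)
EvenIndep? S b = allSubset? λ r →
  (r ⊆? b) →-dec ((parity r Bool.≟ false) →-dec ((sumOver S r ≟ᵖ 𝟎) →-dec (r ≟ᵖ 𝟎)))

Redundant? : ∀ {n k} (S : Fam n k) i → Dec (Redundant S i)
Redundant? S i = anySubset? λ p →
  (lookup p i Bool.≟ false) ×-dec ((parity p Bool.≟ true) ×-dec (sumOver S p ≟ᵖ lookup S i))

AllRedundant? : ∀ {n k} (S : Fam n k) → Dec (AllRedundant S)
AllRedundant? S = Fin.all? (Redundant? S)

module InjectiveLinear {m m′} (L : Pt m → Pt m′) (linear : IsLin L) (injective : ∀ x y → L x ≡ L y → x ≡ y) where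

  sumOver-map : ∀ {k} (V : Fam m k) p → sumOver (map L V) p ≡ L (sumOver V p)
  sumOver-map V p = sym (IsLin-sumOver linear V p)

  sumOver-map≡𝟎 : ∀ {k} (V : Fam m k) p → sumOver (map L V) p ≡ 𝟎 → sumOver V p ≡ 𝟎
  sumOver-map≡𝟎 V p eq = injective _ _ (trans (sym (sumOver-map V p)) (trans eq (sym (IsLin-𝟎 linear))))

  sumOver-map≡lookup : ∀ {k} (V : Fam m k) p i → sumOver V p ≡ lookup V i → sumOver (map L V) p ≡ lookup (map L V) i
  sumOver-map≡lookup V p i eq = trans (sumOver-map V p) (trans (cong L eq) (sym (lookup-map i L V)))

  Distinct-map : ∀ {k} (V : Fam m k) → Distinct V → Distinct (map L V)
  Distinct-map V distinct i j eq = distinct i j (injective _ _ (trans (sym (lookup-map i L V)) (trans eq (lookup-map j L V))))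

  IsCap-map : ∀ {k} (V : Fam m k) → IsCap V → IsCap (map L V)
  IsCap-map V cap p ∣p∣≡4 sum≡𝟎 = cap p ∣p∣≡4 (sumOver-map≡𝟎 V p sum≡𝟎)

  EvenIndep-map : ∀ {k} (V : Fam m k) b → EvenIndep V b → EvenIndep (map L V) b
  EvenIndep-map V b indep r r⊆b even sum≡𝟎 = indep r r⊆b even (sumOver-map≡𝟎 V r sum≡𝟎)

  AffOn-map : ∀ {k} (V : Fam m k) b x → AffOn V b x → AffOn (map L V) b (L x)
  AffOn-map V b x (p , p⊆b , odd , sum≡x) = p , p⊆b , odd , trans (sumOver-map V p) (cong L sum≡x)

  AffOn-map-member : ∀ {k l} (X : Fam m l) (V : Fam m k) b → (∀ i → AffOn V b (lookup X i)) →
    ∀ i → AffOn (map L V) b (lookup (map L X) i)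
  AffOn-map-member X V b X⊆hull i = subst (AffOn (map L V) b) (sym (lookup-map i L X)) (AffOn-map V b _ (X⊆hull i))

  AllRedundant-map : ∀ {k} (V : Fam m k) → AllRedundant V → AllRedundant (map L V)
  AllRedundant-map V redundant i with redundant i
  ... | p , p-i , odd , sum≡ = p , p-i , odd , sumOver-map≡lookup V p i sum≡

  SomeEssential-map : ∀ {k} (V : Fam m k) → SomeEssential V → SomeEssential (map L V)
  SomeEssential-map V (i , essential) = i , λ (p , p-i , odd , sum≡) → essential
    (p , p-i , odd , injective _ _ (trans (sym (sumOver-map V p)) (trans sum≡ (lookup-map i L V))))

  HasExtType-map : ∀ {k} (V : Fam m k) b n₁ n₂ n₃ → HasExtType V b n₁ n₂ n₃ → HasExtType (map L V) b n₁ n₂ n₃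
  HasExtType-map V b n₁ n₂ n₃ (i₁ , i₂ , i₁∉b , i₂∉b , i₁≢i₂ , D≡ , p₁ , p₂ , p₁⊆b , p₂⊆b , sum₁ , sum₂ , sizes) =
    i₁ , i₂ , i₁∉b , i₂∉b , i₁≢i₂ , D≡ , p₁ , p₂ , p₁⊆b , p₂⊆b ,
    sumOver-map≡lookup V p₁ i₁ sum₁ , sumOver-map≡lookup V p₂ i₂ sum₂ , sizes

pad : ∀ {m} k → Pt m → Pt (m + k)
pad k []      = replicate k false
pad k (a ∷ v) = a ∷ pad k v

pad-linear : ∀ {m} k → IsLin (pad {m} k)
pad-linear k []      []      = sym (⊕-identityˡ 𝟎)
pad-linear k (a ∷ x) (b ∷ y) = cong ((a xor b) ∷_) (pad-linear k x y)

pad-injective : ∀ {m} k (x y : Pt m) → pad k x ≡ pad k y → x ≡ y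
pad-injective k []      []      _  = refl
pad-injective k (a ∷ x) (b ∷ y) eq = cong₂ _∷_ (cong head eq) (pad-injective k x y (cong tail eq))

-- The two model caps

-- Both models extend the standard affine basis 𝟎, e₁, …, e₇ of Z₂⁷ by two points whose supports
-- over it are {0,…,4}, {3,…,7} in K₁ (type 5-5-(2)) and {0,…,4}, {2,…,6} in K₂ (type 5-5-(3)).
standard : Fam 7 8
standard = 𝟎 ∷ tabulate ⁅_⁆

interval : ∀ {k} → ℕ → ℕ → Subset k
interval a b = tabulate λ i → (a ≤ᵇ toℕ i) ∧ (toℕ i ≤ᵇ b)

extend : Subset 8 → Subset 8 → Fam 7 10
extend P₁ P₂ = standard Vec.++ (sumOver standard P₁ ∷ sumOver standard P₂ ∷ [])

K₁ K₂ : Fam 7 10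
K₁ = extend (interval 0 4) (interval 3 7)
K₂ = extend (interval 0 4) (interval 2 6)

K₁-distinct : Distinct K₁
K₁-distinct = toWitness {a? = Distinct? K₁} _

K₂-distinct : Distinct K₂
K₂-distinct = toWitness {a? = Distinct? K₂} _

K₁-cap : IsCap K₁
K₁-cap = toWitness {a? = IsCap? K₁} _

K₂-cap : IsCap K₂
K₂-cap = toWitness {a? = IsCap? K₂} _

K₁-allRedundant : AllRedundant K₁
K₁-allRedundant = toWitness {a? = AllRedundant? K₁} _

K₂-essential : ¬ Redundant K₂ (# 7)
K₂-essential = toWitness {a? = ¬? (Redundant? K₂ (# 7))} _

at : List (Fin 10) → ℕ → Fin 10
at []       _       = zero
at (x ∷ xs) zero    = x
at (x ∷ xs) (suc n) = at xs n

Table : Set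
Table = Vec (Fin 10) 10

fromList : List (Fin 10) → Table
fromList l = tabulate λ j → at l (toℕ j)

invert : Table → Table
invert τ = tabulate λ i → search i (List.allFin 10)
  where
  search : Fin 10 → List (Fin 10) → Fin 10
  search i []       = zero
  search i (j ∷ js) = if ⌊ lookup τ j Fin.≟ i ⌋ then j else search i js

members : ∀ {l} → Subset l → List (Fin l)
members []          = []
members (true ∷ p)  = zero ∷ List.map suc (members p)
members (false ∷ p) = List.map suc (members p)

AreInverse? : (σ τ : Fin 10 → Fin 10) → Dec (AreInverse σ τ)
AreInverse? σ τ = map′ (λ (τσ , στ) → inverses τσ στ) (λ inv → AreInverse.τ∘σ inv , AreInverse.σ∘τ inv)
  (Fin.all? (λ i → τ (σ i) Fin.≟ i) ×-dec Fin.all? (λ j → σ (τ j) Fin.≟ j))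

low8 : Subset 10
low8 = interval 0 7

record MovesOntoLow8 (b : Subset 10) (σ τ : Fin 10 → Fin 10) : Set where
  field
    inverse : AreInverse σ τ
    basis   : ∀ i → lookup b i ≡ true → lookup low8 (σ i) ≡ true
    rest    : ∀ i → lookup b i ≡ false → lookup low8 (σ i) ≡ false

MovesOntoLow8? : ∀ b σ τ → Dec (MovesOntoLow8 b σ τ)
MovesOntoLow8? b σ τ = map′ (λ (inv , bas , res) → record { inverse = inv ; basis = bas ; rest = res })
  (λ m → MovesOntoLow8.inverse m , MovesOntoLow8.basis m , MovesOntoLow8.rest m)
  (AreInverse? σ τ ×-dec (Fin.all? (λ i → (lookup b i Bool.≟ true) →-dec (lookup low8 (σ i) Bool.≟ true))
                    ×-dec Fin.all? (λ i → (lookup b i Bool.≟ false) →-dec (lookup low8 (σ i) Bool.≟ false))))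

low8-table : Subset 10 → Table
low8-table b = fromList (members b ++ members (∁ b))

MovesOntoLow8ᵗ? : ∀ b τ → Dec (MovesOntoLow8 b (lookup (invert τ)) (lookup τ))
MovesOntoLow8ᵗ? b τ = MovesOntoLow8? b (lookup (invert τ)) (lookup τ)

-- The relabellings are opaque so that conversion checking never unfolds the search in invert;
-- the checks pass the tables as arguments so that their entries are computed once.
opaque
  σ-low8 τ-low8 : Subset 10 → Fin 10 → Fin 10
  σ-low8 b = lookup (invert (low8-table b))
  τ-low8 b = lookup (low8-table b)

  movesOntoLow8 : ∀ b → ∣ b ∣ ≡ 8 → MovesOntoLow8 b (σ-low8 b) (τ-low8 b)
  movesOntoLow8 = toWitness {a? = allSubset? λ b → (∣ b ∣ ℕ.≟ 8) →-dec MovesOntoLow8ᵗ? b (low8-table b)} _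

data Shape : Set where
  s552 s754 s553 : Shape

capOf : Shape → Fam 7 10
capOf s553 = K₂
capOf _    = K₁

basisOf : Shape → Subset 10
basisOf s754 = ∁ (⁅ # 3 ⁆ ∪ ⁅ # 9 ⁆)
basisOf _    = low8

is553? : ∀ sh → Dec (sh ≡ s553)
is553? s553 = yes refl
is553? s552 = no λ ()
is553? s754 = no λ ()

-- σ turns the supports P₁, P₂ over low8 of the dependent points 8 and 9 into those of the
-- model capOf sh over its basis basisOf sh.
record Matches (P₁ P₂ : Subset 10) (sh : Shape) (σ τ : Fin 10 → Fin 10) : Set where
  field
    inverse : AreInverse σ τ
    basis   : ∀ i → lookup low8 i ≡ true → lookup (basisOf sh) (σ i) ≡ true
    sum₁    : sumOver (capOf sh) (push σ P₁) ≡ lookup (capOf sh) (σ (# 8))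
    sum₂    : sumOver (capOf sh) (push σ P₂) ≡ lookup (capOf sh) (σ (# 9))
    type553 : sh ≡ s553 → ∣ P₁ ∣ ≡ 5 × ∣ P₂ ∣ ≡ 5 × ∣ P₁ ∩ P₂ ∣ ≡ 3

Matches? : ∀ P₁ P₂ sh σ τ → Dec (Matches P₁ P₂ sh σ τ)
Matches? P₁ P₂ sh σ τ = map′ (λ (inv , bas , s₁ , s₂ , t) → record { inverse = inv ; basis = bas ; sum₁ = s₁ ; sum₂ = s₂ ; type553 = t })
  (λ m → Matches.inverse m , Matches.basis m , Matches.sum₁ m , Matches.sum₂ m , Matches.type553 m)
  (AreInverse? σ τ ×-dec
   (Fin.all? (λ i → (lookup low8 i Bool.≟ true) →-dec (lookup (basisOf sh) (σ i) Bool.≟ true)) ×-dec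
   ((sumOver (capOf sh) (push σ P₁) ≟ᵖ lookup (capOf sh) (σ (# 8))) ×-dec
   ((sumOver (capOf sh) (push σ P₂) ≟ᵖ lookup (capOf sh) (σ (# 9))) ×-dec
   (is553? sh →-dec ((∣ P₁ ∣ ℕ.≟ 5) ×-dec ((∣ P₂ ∣ ℕ.≟ 5) ×-dec (∣ P₁ ∩ P₂ ∣ ℕ.≟ 3))))))))

-- The shape, and the relabelling τ from model indices to indices, found by grouping the basis
-- indices according to which of the supports P₁, P₂ contain them.
match : Subset 10 → Subset 10 → Shape × Table
match P₁ P₂ = go (members (P₁ ∩ P₂)) (members (P₁ ∩ ∁ P₂)) (members (P₂ ∩ ∁ P₁)) (members (low8 ∩ ∁ (P₁ ∪ P₂)))
  where
  go : List (Fin 10) → List (Fin 10) → List (Fin 10) → List (Fin 10) → Shape × Table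
  go I J K R = if ∣ P₁ ∣ ≡ᵇ 7
    then (s754 , fromList (at I 1 ∷ at I 2 ∷ at I 3 ∷ # 9 ∷ at K 0 ∷ at J 0 ∷ at J 1 ∷ at J 2 ∷ at I 0 ∷ # 8 ∷ []))
    else if ∣ P₂ ∣ ≡ᵇ 7
    then (s754 , fromList (at I 1 ∷ at I 2 ∷ at I 3 ∷ # 8 ∷ at J 0 ∷ at K 0 ∷ at K 1 ∷ at K 2 ∷ at I 0 ∷ # 9 ∷ []))
    else ((if ∣ P₁ ∩ P₂ ∣ ≡ᵇ 3 then s553 else s552) , fromList (J ++ I ++ K ++ R ++ # 8 ∷ # 9 ∷ []))

lift : ∀ {m} → Subset m → Subset (m + 2)
lift a = a Vec.++ (false ∷ false ∷ [])

Size5or7 : Subset 8 → Set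
Size5or7 a = ∣ a ∣ ≡ 5 ⊎ ∣ a ∣ ≡ 7

Size5or7? : ∀ a → Dec (Size5or7 a)
Size5or7? a = (∣ a ∣ ℕ.≟ 5) ⊎-dec (∣ a ∣ ℕ.≟ 7)

Apart : Subset 8 → Subset 8 → Set
Apart a₁ a₂ = ∣ a₁ ⊕ a₂ ∣ ≢ 0 × ∣ a₁ ⊕ a₂ ∣ ≢ 2

Apart? : ∀ a₁ a₂ → Dec (Apart a₁ a₂)
Apart? a₁ a₂ = ¬? (∣ a₁ ⊕ a₂ ∣ ℕ.≟ 0) ×-dec ¬? (∣ a₁ ⊕ a₂ ∣ ℕ.≟ 2)

Matchesᵗ? : ∀ P₁ P₂ (m : Shape × Table) → Dec (Matches P₁ P₂ (proj₁ m) (lookup (invert (proj₂ m))) (lookup (proj₂ m)))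
Matchesᵗ? P₁ P₂ m = Matches? P₁ P₂ (proj₁ m) (lookup (invert (proj₂ m))) (lookup (proj₂ m))

opaque
  shape : Subset 10 → Subset 10 → Shape
  shape P₁ P₂ = proj₁ (match P₁ P₂)

  σ-match τ-match : Subset 10 → Subset 10 → Fin 10 → Fin 10
  σ-match P₁ P₂ = lookup (invert (proj₂ (match P₁ P₂)))
  τ-match P₁ P₂ = lookup (proj₂ (match P₁ P₂))

  matches : ∀ a₁ → Size5or7 a₁ → ∀ a₂ → Size5or7 a₂ → Apart a₁ a₂ →
    Matches (lift a₁) (lift a₂) (shape (lift a₁) (lift a₂)) (σ-match (lift a₁) (lift a₂)) (τ-match (lift a₁) (lift a₂))
  matches = toWitness {a? = allSubset? λ a₁ → Size5or7? a₁ →-dec allSubset? λ a₂ → Size5or7? a₂ →-dec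
    Apart? a₁ a₂ →-dec Matchesᵗ? (lift a₁) (lift a₂) (match (lift a₁) (lift a₂))} _

standard-indep : EvenIndep standard ⊤
standard-indep = toWitness {a? = EvenIndep? standard ⊤} _

standard-spans : ∀ sh i → AffOn standard ⊤ (lookup (capOf sh) i)
standard-spans s552 = toWitness {a? = Fin.all? λ i → AffOn? standard ⊤ (lookup K₁ i)} _
standard-spans s754 = standard-spans s552
standard-spans s553 = toWitness {a? = Fin.all? λ i → AffOn? standard ⊤ (lookup K₂ i)} _

standard⊆model : ∀ sh i → AffOn (capOf sh) ⊤ (lookup standard i)
standard⊆model s552 = toWitness {a? = Fin.all? λ i → AffOn? K₁ ⊤ (lookup standard i)} _
standard⊆model s754 = standard⊆model s552
standard⊆model s553 = toWitness {a? = Fin.all? λ i → AffOn? K₂ ⊤ (lookup standard i)} _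

basisOf-indep : ∀ sh → EvenIndep (capOf sh) (basisOf sh)
basisOf-indep s552 = toWitness {a? = EvenIndep? K₁ low8} _
basisOf-indep s754 = toWitness {a? = EvenIndep? K₁ (basisOf s754)} _
basisOf-indep s553 = toWitness {a? = EvenIndep? K₂ low8} _

basisOf-spans : ∀ sh i → AffOn (capOf sh) (basisOf sh) (lookup (capOf sh) i)
basisOf-spans s552 = toWitness {a? = Fin.all? λ i → AffOn? K₁ low8 (lookup K₁ i)} _
basisOf-spans s754 = toWitness {a? = Fin.all? λ i → AffOn? K₁ (basisOf s754) (lookup K₁ i)} _
basisOf-spans s553 = toWitness {a? = Fin.all? λ i → AffOn? K₂ low8 (lookup K₂ i)} _

K₁-type552 : HasExtType K₁ low8 5 5 2
K₁-type552 = # 8 , # 9 , toWitness {a? = ¬? (# 8 ∈? low8)} _ , toWitness {a? = ¬? (# 9 ∈? low8)} _ , (λ ()) ,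
  toWitness {a? = Fin.all? λ j → ¬? (j ∈? low8) →-dec ((j Fin.≟ # 8) ⊎-dec (j Fin.≟ # 9))} _ ,
  interval 0 4 , interval 3 7 , toWitness {a? = interval 0 4 ⊆? low8} _ , toWitness {a? = interval 3 7 ⊆? low8} _ ,
  refl , refl , refl , refl , refl

K₁-type754 : HasExtType K₁ (basisOf s754) 7 5 4
K₁-type754 = # 9 , # 3 , toWitness {a? = ¬? (# 9 ∈? basisOf s754)} _ , toWitness {a? = ¬? (# 3 ∈? basisOf s754)} _ , (λ ()) ,
  toWitness {a? = Fin.all? λ j → ¬? (j ∈? basisOf s754) →-dec ((j Fin.≟ # 9) ⊎-dec (j Fin.≟ # 3))} _ ,
  ∁ (⁅ # 3 ⁆ ∪ ⁅ # 4 ⁆ ∪ ⁅ # 9 ⁆) , interval 0 2 ∪ ⁅ # 4 ⁆ ∪ ⁅ # 8 ⁆ ,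
  toWitness {a? = _ ⊆? basisOf s754} _ , toWitness {a? = _ ⊆? basisOf s754} _ ,
  refl , refl , refl , refl , refl

standard-distinct : Distinct standard
standard-distinct = toWitness {a? = Distinct? standard} _

capOf-distinct : ∀ sh → Distinct (capOf sh)
capOf-distinct s552 = K₁-distinct
capOf-distinct s754 = K₁-distinct
capOf-distinct s553 = K₂-distinct

capOf-cap : ∀ sh → IsCap (capOf sh)
capOf-cap s552 = K₁-cap
capOf-cap s754 = K₁-cap
capOf-cap s553 = K₂-cap

-- Classification

∉-support : ∀ {k} {b p : Subset k} {i} → lookup b i ≡ false → p ⊆ b → lookup p i ≡ false
∉-support {p = p} {i} b-i p⊆b with lookup p i in p-i
... | true  = ⊥-elim (true≢false (trans (sym (⊆⇒lookup p⊆b i p-i)) b-i))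
... | false = refl

support≢1 : ∀ {n k} (S : Fam n k) {b p : Subset k} {i} → Distinct S → lookup b i ≡ false → p ⊆ b →
  sumOver S p ≡ lookup S i → ∣ p ∣ ≢ 1
support≢1 S {b} {p} {i} distinct b-i p⊆b sum≡ ∣p∣≡1 with ∣p∣>0⇒nonempty p (subst (0 <_) (sym ∣p∣≡1) (s≤s z≤n))
... | j , p-j = true≢false (trans (sym (⊆⇒lookup p⊆b j p-j)) (trans (cong (lookup b) (sym i≡j)) b-i))
  where
  p≡⁅j⁆ : p ≡ ⁅ j ⁆
  p≡⁅j⁆ = ⊕≡𝟎⇒≡ p ⁅ j ⁆ (∣p∣≡0⇒p≡𝟎 (p ⊕ ⁅ j ⁆) (ℕ.suc-injective (trans (sym (∈⇒∣p∣≡suc∣p⊕⁅x⁆∣ p j p-j)) ∣p∣≡1)))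
  i≡j : i ≡ j
  i≡j = distinct i j (trans (sym sum≡) (trans (cong (sumOver S) p≡⁅j⁆) (sumOver-⁅⁆ S j)))

support≢3 : ∀ {n k} (S : Fam n k) {b p : Subset k} {i} → IsCap S → lookup b i ≡ false → p ⊆ b →
  sumOver S p ≡ lookup S i → ∣ p ∣ ≢ 3
support≢3 S {p = p} {i} cap b-i p⊆b sum≡ ∣p∣≡3 = cap (p ⊕ ⁅ i ⁆)
  (trans (∉⇒∣p⊕⁅x⁆∣≡suc∣p∣ p i (∉-support b-i p⊆b)) (cong suc ∣p∣≡3))
  (trans (sumOver-⊕⁅⁆ S p i) (trans (cong (_⊕ lookup S i) sum≡) (⊕-self _)))

odd≤8⇒5or7 : ∀ m → oddᵇ m ≡ true → m ≤ 8 → m ≢ 1 → m ≢ 3 → m ≡ 5 ⊎ m ≡ 7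
odd≤8⇒5or7 1 _ _ m≢1 _   = ⊥-elim (m≢1 refl)
odd≤8⇒5or7 3 _ _ _   m≢3 = ⊥-elim (m≢3 refl)
odd≤8⇒5or7 5 _ _ _   _   = inj₁ refl
odd≤8⇒5or7 7 _ _ _   _   = inj₂ refl
odd≤8⇒5or7 (suc (suc (suc (suc (suc (suc (suc (suc (suc m)))))))))
  _ (s≤s (s≤s (s≤s (s≤s (s≤s (s≤s (s≤s (s≤s ())))))))) _ _

supports-≢0 : ∀ {n k} (S : Fam n k) {p₁ p₂ : Subset k} {i₁ i₂} → Distinct S → i₁ ≢ i₂ →
  sumOver S p₁ ≡ lookup S i₁ → sumOver S p₂ ≡ lookup S i₂ → ∣ p₁ ⊕ p₂ ∣ ≢ 0
supports-≢0 S {p₁} {p₂} distinct i₁≢i₂ sum₁ sum₂ ∣p₁⊕p₂∣≡0 = i₁≢i₂ (distinct _ _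
  (trans (sym sum₁) (trans (cong (sumOver S) (⊕≡𝟎⇒≡ p₁ p₂ (∣p∣≡0⇒p≡𝟎 (p₁ ⊕ p₂) ∣p₁⊕p₂∣≡0))) sum₂)))

supports-≢2 : ∀ {n k} (S : Fam n k) {b p₁ p₂ : Subset k} {i₁ i₂} → IsCap S → i₁ ≢ i₂ →
  lookup b i₁ ≡ false → lookup b i₂ ≡ false → p₁ ⊆ b → p₂ ⊆ b →
  sumOver S p₁ ≡ lookup S i₁ → sumOver S p₂ ≡ lookup S i₂ → ∣ p₁ ⊕ p₂ ∣ ≢ 2
supports-≢2 S {b} {p₁} {p₂} {i₁} {i₂} cap i₁≢i₂ b-i₁ b-i₂ p₁⊆b p₂⊆b sum₁ sum₂ ∣r∣≡2 = cap (r₁ ⊕ ⁅ i₂ ⁆)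
  (trans (∉⇒∣p⊕⁅x⁆∣≡suc∣p∣ r₁ i₂ r₁-i₂) (cong suc (trans (∉⇒∣p⊕⁅x⁆∣≡suc∣p∣ r i₁ (∉-support b-i₁ r⊆b)) (cong suc ∣r∣≡2))))
  (begin
    sumOver S (r₁ ⊕ ⁅ i₂ ⁆)                             ≡⟨ sumOver-⊕⁅⁆ S r₁ i₂ ⟩
    sumOver S (r ⊕ ⁅ i₁ ⁆) ⊕ lookup S i₂                ≡⟨ cong (_⊕ lookup S i₂) (sumOver-⊕⁅⁆ S r i₁) ⟩
    (sumOver S r ⊕ lookup S i₁) ⊕ lookup S i₂           ≡⟨ cong (λ x → (x ⊕ lookup S i₁) ⊕ lookup S i₂)
                                                             (trans (sumOver-⊕ S p₁ p₂) (cong₂ _⊕_ sum₁ sum₂)) ⟩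
    ((lookup S i₁ ⊕ lookup S i₂) ⊕ lookup S i₁) ⊕ lookup S i₂ ≡⟨ cong (_⊕ lookup S i₂) (x⊕y⊕x≡y (lookup S i₁) (lookup S i₂)) ⟩
    lookup S i₂ ⊕ lookup S i₂                           ≡⟨ ⊕-self _ ⟩
    𝟎                                                   ∎)
  where
  r = p₁ ⊕ p₂
  r⊆b = ⊕-⊆ p₁⊆b p₂⊆b
  r₁ = r ⊕ ⁅ i₁ ⁆
  r₁-i₂ : lookup r₁ i₂ ≡ false
  r₁-i₂ = trans (lookup-⊕⁅y⁆ r (λ eq → i₁≢i₂ (sym eq))) (∉-support b-i₂ r⊆b)

∣lift∣ : ∀ {m} (a : Subset m) → ∣ lift a ∣ ≡ ∣ a ∣
∣lift∣ []          = refl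
∣lift∣ (true ∷ a)  = cong suc (∣lift∣ a)
∣lift∣ (false ∷ a) = ∣lift∣ a

lift-⊕ : ∀ {m} (a b : Subset m) → lift (a ⊕ b) ≡ lift a ⊕ lift b
lift-⊕ []      []      = refl
lift-⊕ (x ∷ a) (y ∷ b) = cong ((x xor y) ∷_) (lift-⊕ a b)

⊆low8⇒lift : (P : Subset 10) → P ⊆ low8 → ∃ λ (a : Subset 8) → lift a ≡ P
⊆low8⇒lift (p₀ ∷ p₁ ∷ p₂ ∷ p₃ ∷ p₄ ∷ p₅ ∷ p₆ ∷ p₇ ∷ p₈ ∷ p₉ ∷ []) P⊆low8 =
  last-two p₈ p₉ (⊆⇒lookup P⊆low8 (# 8)) (⊆⇒lookup P⊆low8 (# 9))
  where
  last-two : ∀ x y → (x ≡ true → false ≡ true) → (y ≡ true → false ≡ true) →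
    ∃ λ (a : Subset 8) → lift a ≡ (p₀ ∷ p₁ ∷ p₂ ∷ p₃ ∷ p₄ ∷ p₅ ∷ p₆ ∷ p₇ ∷ x ∷ y ∷ [])
  last-two false false _ _ = (p₀ ∷ p₁ ∷ p₂ ∷ p₃ ∷ p₄ ∷ p₅ ∷ p₆ ∷ p₇ ∷ []) , refl
  last-two true  _     h _ with h refl
  ... | ()
  last-two false true  _ h with h refl
  ... | ()

outside-low8 : ∀ j → lookup low8 j ≡ false → j ≡ # 8 ⊎ j ≡ # 9
outside-low8 = toWitness {a? = Fin.all? λ j → (lookup low8 j Bool.≟ false) →-dec ((j Fin.≟ # 8) ⊎-dec (j Fin.≟ # 9))} _

module Models (k : ℕ) where
  open InjectiveLinear (pad {7} k) (pad-linear k) (pad-injective k)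

  model : Shape → Fam (7 + k) 10
  model sh = map (pad k) (capOf sh)

  model-indep : ∀ sh → EvenIndep (model sh) (basisOf sh)
  model-indep sh = EvenIndep-map (capOf sh) (basisOf sh) (basisOf-indep sh)

  model-spans : ∀ sh x → Aff (model sh) x → AffOn (model sh) (basisOf sh) x
  model-spans sh = Aff⊆AffOn (model sh) (model sh) (basisOf sh) (AffOn-map-member (capOf sh) (capOf sh) (basisOf sh) (basisOf-spans sh))

  model-basis : ∀ sh → IsBasis (model sh) (basisOf sh)
  model-basis sh = EvenIndep⇒AffIndepOn (model sh) (basisOf sh) (model-indep sh) ,
    λ x → AffOn⇒Aff (model sh) (basisOf sh) x , model-spans sh x

  model-dim : ∀ sh → HasDim (model sh) 7
  model-dim sh = map (pad k) standard , Distinct-map standard standard-distinct ,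
    AffOn-map-member standard (capOf sh) ⊤ (standard⊆model sh) ,
    EvenIndep⇒AffIndepOn (map (pad k) standard) ⊤ (EvenIndep-map standard ⊤ standard-indep) ,
    λ x → Aff⊆AffOn (map (pad k) standard) (model sh) ⊤ (AffOn-map-member standard (capOf sh) ⊤ (standard⊆model sh)) x ,
          Aff⊆AffOn (model sh) (map (pad k) standard) ⊤ (AffOn-map-member (capOf sh) standard ⊤ (standard-spans sh)) x

  model-dimCap : ∀ sh → IsDimCap 7 10 (model sh)
  model-dimCap sh = Distinct-map (capOf sh) (capOf-distinct sh) , IsCap-map (capOf sh) (capOf-cap sh) , model-dim sh

  model₁-allRedundant : AllRedundant (model s552)
  model₁-allRedundant = AllRedundant-map K₁ K₁-allRedundant

  model₂-essential : SomeEssential (model s553)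
  model₂-essential = SomeEssential-map K₂ (# 7 , K₂-essential)

  model-type552 : HasExtType (model s552) low8 5 5 2
  model-type552 = HasExtType-map K₁ low8 5 5 2 K₁-type552

  model-type754 : HasExtType (model s754) (basisOf s754) 7 5 4
  model-type754 = HasExtType-map K₁ (basisOf s754) 7 5 4 K₁-type754

  Classification : Fam (7 + k) 10 → Subset 10 → Set
  Classification S b = Σ Shape λ sh → AffIso S (model sh) × (sh ≡ s553 → HasExtType S b 5 5 3)

  module Analysis (S : Fam (7 + k) 10) (S-dimCap : IsDimCap 7 10 S) (b : Subset 10) (b-indep : EvenIndep S b)
                  (b-spans : ∀ x → Aff S x → AffOn S b x) where

    S-distinct = proj₁ S-dimCap
    S-cap = proj₁ (proj₂ S-dimCap)

    ∣b∣≡8 : ∣ b ∣ ≡ 8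
    ∣b∣≡8 = basis-card S (proj₂ (proj₂ S-dimCap)) b b-indep b-spans

    moves₁ : MovesOntoLow8 b (σ-low8 b) (τ-low8 b)
    moves₁ = movesOntoLow8 b ∣b∣≡8

    open MovesOntoLow8 moves₁ renaming (inverse to inv₁; basis to basis₁; rest to rest₁)
    σ₁ = σ-low8 b
    τ₁ = τ-low8 b

    τ₁-outside : ∀ j → lookup low8 j ≡ false → lookup b (τ₁ j) ≡ false
    τ₁-outside j low8-j with lookup b (τ₁ j) in b-τj
    ... | true  = ⊥-elim (true≢false (trans (sym (basis₁ (τ₁ j) b-τj))
                    (trans (cong (lookup low8) (AreInverse.σ∘τ inv₁ j)) low8-j)))
    ... | false = refl

    i₁ i₂ : Fin 10
    i₁ = τ₁ (# 8)
    i₂ = τ₁ (# 9)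

    b-i₁ : lookup b i₁ ≡ false
    b-i₁ = τ₁-outside (# 8) refl
    b-i₂ : lookup b i₂ ≡ false
    b-i₂ = τ₁-outside (# 9) refl

    i₁≢i₂ : i₁ ≢ i₂
    i₁≢i₂ eq with AreInverse⇒injective (AreInverse-sym inv₁) (# 8) (# 9) eq
    ... | ()

    support : ∀ i → AffOn S b (lookup S i)
    support i = b-spans (lookup S i) (Aff-member S i)
    p₁ = proj₁ (support i₁)
    p₂ = proj₁ (support i₂)
    p₁⊆b = proj₁ (proj₂ (support i₁))
    p₂⊆b = proj₁ (proj₂ (support i₂))
    p₁-odd = proj₁ (proj₂ (proj₂ (support i₁)))
    p₂-odd = proj₁ (proj₂ (proj₂ (support i₂)))
    sum₁ = proj₂ (proj₂ (proj₂ (support i₁)))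
    sum₂ = proj₂ (proj₂ (proj₂ (support i₂)))

    size5or7 : ∀ {i p} → lookup b i ≡ false → p ⊆ b → Odd ∣ p ∣ → sumOver S p ≡ lookup S i → ∣ p ∣ ≡ 5 ⊎ ∣ p ∣ ≡ 7
    size5or7 {i} {p} b-i p⊆b odd sum≡ = odd≤8⇒5or7 ∣ p ∣ (Odd⇒oddᵇ ∣ p ∣ odd) (subst (∣ p ∣ ≤_) ∣b∣≡8 (p⊆q⇒∣p∣≤∣q∣ p⊆b))
      (support≢1 S S-distinct b-i p⊆b sum≡) (support≢3 S S-cap b-i p⊆b sum≡)

    P₁ = push σ₁ p₁
    P₂ = push σ₁ p₂
    P⊆low8 : ∀ {p} → p ⊆ b → push σ₁ p ⊆ low8
    P⊆low8 p⊆b = push-⊆ inv₁ p⊆b basis₁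
    a₁ = proj₁ (⊆low8⇒lift P₁ (P⊆low8 p₁⊆b))
    a₂ = proj₁ (⊆low8⇒lift P₂ (P⊆low8 p₂⊆b))
    lift-a₁ : lift a₁ ≡ P₁
    lift-a₁ = proj₂ (⊆low8⇒lift P₁ (P⊆low8 p₁⊆b))
    lift-a₂ : lift a₂ ≡ P₂
    lift-a₂ = proj₂ (⊆low8⇒lift P₂ (P⊆low8 p₂⊆b))

    ∣push∣ : ∀ p → ∣ push σ₁ p ∣ ≡ ∣ p ∣
    ∣push∣ = card-push σ₁ (AreInverse⇒injective inv₁)
    ∣a₁∣ : ∣ a₁ ∣ ≡ ∣ p₁ ∣
    ∣a₁∣ = trans (sym (∣lift∣ a₁)) (trans (cong ∣_∣ lift-a₁) (∣push∣ p₁))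
    ∣a₂∣ : ∣ a₂ ∣ ≡ ∣ p₂ ∣
    ∣a₂∣ = trans (sym (∣lift∣ a₂)) (trans (cong ∣_∣ lift-a₂) (∣push∣ p₂))
    ∣a₁⊕a₂∣ : ∣ a₁ ⊕ a₂ ∣ ≡ ∣ p₁ ⊕ p₂ ∣
    ∣a₁⊕a₂∣ = trans (sym (∣lift∣ (a₁ ⊕ a₂)))
      (trans (cong ∣_∣ (trans (lift-⊕ a₁ a₂) (trans (cong₂ _⊕_ lift-a₁ lift-a₂) (sym (push-⊕ σ₁ p₁ p₂)))))
             (∣push∣ (p₁ ⊕ p₂)))

    a₁-size : Size5or7 a₁
    a₁-size = subst (λ m → m ≡ 5 ⊎ m ≡ 7) (sym ∣a₁∣) (size5or7 b-i₁ p₁⊆b p₁-odd sum₁)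
    a₂-size : Size5or7 a₂
    a₂-size = subst (λ m → m ≡ 5 ⊎ m ≡ 7) (sym ∣a₂∣) (size5or7 b-i₂ p₂⊆b p₂-odd sum₂)
    apart : Apart a₁ a₂
    apart = (λ eq → supports-≢0 S S-distinct i₁≢i₂ sum₁ sum₂ (trans (sym ∣a₁⊕a₂∣) eq)) ,
            (λ eq → supports-≢2 S S-cap i₁≢i₂ b-i₁ b-i₂ p₁⊆b p₂⊆b sum₁ sum₂ (trans (sym ∣a₁⊕a₂∣) eq))

    sh = shape P₁ P₂
    σ₂ = σ-match P₁ P₂
    τ₂ = τ-match P₁ P₂

    matched : Matches P₁ P₂ sh σ₂ τ₂
    matched = subst₂ (λ P Q → Matches P Q (shape P Q) (σ-match P Q) (τ-match P Q)) lift-a₁ lift-a₂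
      (matches a₁ a₁-size a₂ a₂-size apart)

    open Matches matched renaming (inverse to inv₂; basis to basis₂; sum₁ to matched-sum₁; sum₂ to matched-sum₂; type553 to matched-type553)

    σ : Fin 10 → Fin 10
    σ i = σ₂ (σ₁ i)

    model-sum : ∀ p j → sumOver (capOf sh) p ≡ lookup (capOf sh) j → sumOver (model sh) p ≡ lookup (model sh) j
    model-sum = sumOver-map≡lookup (capOf sh)

    compatible-dependent : ∀ j → lookup b j ≡ false → Compatible S (model sh) b σ j
    compatible-dependent j b-j with outside-low8 (σ₁ j) (rest₁ j b-j)
    ... | inj₁ σ₁j≡8 = p₁ , p₁⊆b , Odd⇒parity p₁ p₁-odd , trans sum₁ (cong (lookup S) i₁≡j) ,
      trans (cong (sumOver (model sh)) (push-∘ σ₂ σ₁ p₁))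
        (trans (model-sum (push σ₂ P₁) (σ₂ (# 8)) matched-sum₁) (cong (λ t → lookup (model sh) (σ₂ t)) (sym σ₁j≡8)))
      where
      i₁≡j : i₁ ≡ j
      i₁≡j = trans (cong τ₁ (sym σ₁j≡8)) (AreInverse.τ∘σ inv₁ j)
    ... | inj₂ σ₁j≡9 = p₂ , p₂⊆b , Odd⇒parity p₂ p₂-odd , trans sum₂ (cong (lookup S) i₂≡j) ,
      trans (cong (sumOver (model sh)) (push-∘ σ₂ σ₁ p₂))
        (trans (model-sum (push σ₂ P₂) (σ₂ (# 9)) matched-sum₂) (cong (λ t → lookup (model sh) (σ₂ t)) (sym σ₁j≡9)))
      where
      i₂≡j : i₂ ≡ j
      i₂≡j = trans (cong τ₁ (sym σ₁j≡9)) (AreInverse.τ∘σ inv₁ j)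

    compatible : ∀ j → Compatible S (model sh) b σ j
    compatible j with lookup b j in b-j
    ... | true  = ⁅ j ⁆ , ⁅⁆-⊆ (lookup⇒[]= j b b-j) , parity-⁅⁆ j , sumOver-⁅⁆ S j ,
                  trans (cong (sumOver (model sh)) (push-⁅⁆ σ j)) (sumOver-⁅⁆ (model sh) (σ j))
    ... | false = compatible-dependent j b-j

    inv : AreInverse σ (λ j → τ₁ (τ₂ j))
    inv = AreInverse-∘ inv₁ inv₂

    j₀ = proj₁ (∣p∣>0⇒nonempty b (subst (0 <_) (sym ∣b∣≡8) (s≤s z≤n)))
    j₀∈b = proj₂ (∣p∣>0⇒nonempty b (subst (0 <_) (sym ∣b∣≡8) (s≤s z≤n)))

    iso : AffIso S (model sh)
    iso = AffIso-fromBasis S (model sh) b (basisOf sh) inv b-indep b-spans (model-indep sh)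
      (λ i b-i → basis₂ (σ₁ i) (basis₁ i b-i)) compatible j₀ j₀∈b

    type553 : sh ≡ s553 → HasExtType S b 5 5 3
    type553 sh≡553 = i₁ , i₂ , lookup≡false⇒∉ b-i₁ , lookup≡false⇒∉ b-i₂ , i₁≢i₂ , D≡ ,
      p₁ , p₂ , p₁⊆b , p₂⊆b , sum₁ , sum₂ ,
      trans (sym (∣push∣ p₁)) (proj₁ sizes) , trans (sym (∣push∣ p₂)) (proj₁ (proj₂ sizes)) ,
      trans (sym (∣push∣ (p₁ ∩ p₂))) (trans (cong ∣_∣ (push-∩ inv₁ p₁ p₂)) (proj₂ (proj₂ sizes)))
      where
      sizes = matched-type553 sh≡553
      D≡ : ∀ j → j ∉ b → j ≡ i₁ ⊎ j ≡ i₂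
      D≡ j j∉b with outside-low8 (σ₁ j) (rest₁ j (∉⇒lookup≡false j∉b))
      ... | inj₁ eq = inj₁ (trans (sym (AreInverse.τ∘σ inv₁ j)) (cong τ₁ eq))
      ... | inj₂ eq = inj₂ (trans (sym (AreInverse.τ∘σ inv₁ j)) (cong τ₁ eq))

    classification : Classification S b
    classification = sh , iso , type553

module Theorem (k : ℕ) where
  open Models k

  classify : ∀ S → IsDimCap 7 10 S → ∀ b → IsBasis S b → Classification S b
  classify S S-dimCap b (indep , spans) =
    Analysis.classification S S-dimCap b (AffIndepOn⇒EvenIndep S b indep) (λ x → proj₂ (spans x))

  some-classification : ∀ S → IsDimCap 7 10 S → ∃[ b ] Classification S b
  some-classification S S-dimCap with basis-exists S
  ... | b , indep , spans = b , Analysis.classification S S-dimCap b indep spans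

  model₁ = model s552
  model₂ = model s553

  model₁-distinct : Distinct model₁
  model₁-distinct = proj₁ (model-dimCap s552)

  class₂-not-class₁ : ∀ S → Distinct S → AffEquiv S model₁ → ¬ AffIso S model₂
  class₂-not-class₁ S S-distinct S≅₁ iso = AllRedundant⇒¬SomeEssential model₁ model₁-allRedundant
    (SomeEssential-transport S model₁ S≅₁ model₁-distinct (SomeEssential-pullback iso model₂-essential))

  class₁-not-class₂ : ∀ S → Distinct S → AffEquiv S model₂ → ¬ AffIso S model₁
  class₁-not-class₂ S S-distinct S≅₂ iso = AllRedundant⇒¬SomeEssential model₂
    (AllRedundant-transport S model₂ S≅₂ S-distinct (AllRedundant-pullback iso model₁-allRedundant)) model₂-essential

  Types₁ : Fam (7 + k) 10 → Set
  Types₁ S = (∃[ b ] (IsBasis S b × HasExtType S b 5 5 2)) × (∃[ b ] (IsBasis S b × HasExtType S b 7 5 4))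

  types₁ : ∀ S → AffIso S model₁ → Types₁ S
  types₁ S iso = (push τ low8 , IsBasis-pullback iso low8 (model-basis s552) , HasExtType-pullback iso low8 5 5 2 refl refl model-type552) ,
                 (push τ (basisOf s754) , IsBasis-pullback iso (basisOf s754) (model-basis s754) ,
                  HasExtType-pullback iso (basisOf s754) 7 5 4 refl refl model-type754)
    where τ = AffIso.τ iso

  dichotomy : ∀ S → IsDimCap 7 10 S → AffEquiv S model₁ ⊎ AffEquiv S model₂
  dichotomy S S-dimCap = by-shape (proj₂ (some-classification S S-dimCap))
    where
    by-shape : ∀ {b} → Classification S b → AffEquiv S model₁ ⊎ AffEquiv S model₂
    by-shape (s552 , iso , _) = inj₁ (AffIso⇒AffEquiv iso)
    by-shape (s754 , iso , _) = inj₁ (AffIso⇒AffEquiv iso)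
    by-shape (s553 , iso , _) = inj₂ (AffIso⇒AffEquiv iso)

  class₁ : ∀ S → IsDimCap 7 10 S → AffEquiv S model₁ → Types₁ S
  class₁ S S-dimCap S≅₁ = by-shape (proj₂ (some-classification S S-dimCap))
    where
    by-shape : ∀ {b} → Classification S b → Types₁ S
    by-shape (s552 , iso , _) = types₁ S iso
    by-shape (s754 , iso , _) = types₁ S iso
    by-shape (s553 , iso , _) = ⊥-elim (class₂-not-class₁ S (proj₁ S-dimCap) S≅₁ iso)

  class₂ : ∀ S → IsDimCap 7 10 S → AffEquiv S model₂ → ∀ b → IsBasis S b → HasExtType S b 5 5 3
  class₂ S S-dimCap S≅₂ b basis = by-shape (classify S S-dimCap b basis)
    where
    by-shape : Classification S b → HasExtType S b 5 5 3
    by-shape (s553 , _   , type553) = type553 refl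
    by-shape (s552 , iso , _)       = ⊥-elim (class₁-not-class₂ S (proj₁ S-dimCap) S≅₂ iso)
    by-shape (s754 , iso , _)       = ⊥-elim (class₁-not-class₂ S (proj₁ S-dimCap) S≅₂ iso)

  not-equivalent : ¬ AffEquiv model₁ model₂
  not-equivalent ≅ = AllRedundant⇒¬SomeEssential model₂
    (AllRedundant-transport model₁ model₂ ≅ model₁-distinct model₁-allRedundant) model₂-essential

corollary5p5 : ∀ (n : ℕ) → 7 ≤ n →
  ∃[ C₁ ] ∃[ C₂ ] (IsDimCap {n} 7 10 C₁ × IsDimCap {n} 7 10 C₂ × ¬ AffEquiv C₁ C₂ ×
    (∀ S → IsDimCap 7 10 S → AffEquiv S C₁ ⊎ AffEquiv S C₂) ×
    (∀ S → IsDimCap 7 10 S → AffEquiv S C₁ →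
      (∃[ b ] (IsBasis S b × HasExtType S b 5 5 2)) ×
      (∃[ b ] (IsBasis S b × HasExtType S b 7 5 4))) ×
    (∀ S → IsDimCap 7 10 S → AffEquiv S C₂ →
      ∀ b → IsBasis S b → HasExtType S b 5 5 3))
corollary5p5 n 7≤n with m≤n⇒∃[o]m+o≡n 7≤n
... | k , refl = model₁ , model₂ , model-dimCap s552 , model-dimCap s553 , not-equivalent ,
                 dichotomy , class₁ , class₂
  where
  open Models k
  open Theorem k
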